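{- $V_c(1)=3\tfrac{3}{7}$, $V_c(2)=b_r(2)=4\tfrac13$, $V_c(3)=b_r(3)=5\tfrac17$, $V_c(4)=b(4)=6$ and $V_c(5)=b_r(5)=6\tfrac14$. All these values are attained by ordinary graphs (i.e., for each $1\le g\le 5$ there is an ordinary graph cellularly embedded in $\Sigma_g$ with a complete left walk whose reduced average valence is $V_c(g)$).
   Context: Graphs are finite and connected, loops and multiple edges allowed ("generalized"); ordinary means no loops and no multiple edges. $S$ = number of vertices. A graph embedded in an oriented surface inherits a polarization: at each vertex, oriented edges based there are cyclically ordered counterclockwise; this defines a permutation $\tau$ of oriented edges, $\tau(o,p)=(p,q)$ where $(p,q)$ immediately follows $(p,o)$ in the cyclic order at $p$. Orbits of $\tau$ are left walks; a left walk is complete if it traverses every unoriented edge at least once. An embedding $G\subset\Sigma$ is cellular if $\Sigma\setminus G$ is a disjoint union of open 2-cells; $\Sigma_g$ is the closed oriented surface of genus $g$. A reduced subgraph of $G$ has the same vertices, no loops, and exactly one edge of $G$ between any two distinct vertices joined in $G$; with $A_r(G)$ its number of edges, $V_r(G)=2A_r(G)/S$. $V_c(g)$ is the supremum of $V_r(G)$ over generalized graphs cellularly embedded in $\Sigma_g$ having a complete left walk for the induced polarization. $b(g):=1+\sqrt{1+6g}$, and $b_r(g):=\max\{\lfloor S_0(g)\rfloor_0-1,\ \lfloor S_1(g)\rfloor_1-1,\ 3+\frac{6g-4}{\lceil S_0(g)\rceil_0},\ 3+\frac{6g-3}{\lceil S_1(g)\rceil_1}\}$ with $S_j(g)=2+\sqrt{6g+j}$,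 where $\lceil x\rceil_0,\lceil x\rceil_1$ are the smallest even/odd integers $\ge x$ and $\lfloor x\rfloor_0,\lfloor x\rfloor_1$ the largest even/odd integers $\le x$. -}

module Defs where

open import Data.Nat as ℕ using (ℕ; zero; suc; _+_; _*_; _∸_; _≤ᵇ_; _≡ᵇ_; _%_)
open import Data.Integer as ℤ using (ℤ; +_)
open import Data.Rational as ℚ using (ℚ; _/_; _⊔_)
open import Data.Fin as Fin using (Fin; toℕ)
open import Data.Fin.Properties as FinP using (any?)
open import Data.Bool using (Bool; true; false; not; if_then_else_; _∧_)
open import Data.List as List using (List; allFin)
open import Data.Nat.ListAction using (sum)
open import Data.Product using (Σ; ∃; ∃-syntax; _×_; _,_; proj₁; proj₂)
open import Data.Product.Properties using (≡-dec)
open import Data.Sum using (_⊎_)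
open import Function using (Surjective)
open import Relation.Binary.PropositionalEquality using (_≡_; _≢_)
open import Relation.Nullary using (¬_; Dec; yes; no)
open import Relation.Nullary.Decidable using (⌊_⌋; _⊎-dec_)

record Graph : Set where
  field
    S A : ℕ
    end : Fin A → Fin S × Fin S

  -- oriented edges: (e , false) goes from proj₁ (end e) to proj₂ (end e),
  -- (e , true) is the reverse orientation.  A loop thus has two darts.
  Dart : Set
  Dart = Fin A × Bool

  base : Dart → Fin S
  base (e , false) = proj₁ (end e)
  base (e , true)  = proj₂ (end e)

  rev : Dart → Dart
  rev (e , b) = (e , not b)

  Adj : Fin S → Fin S → Set
  Adj u v = ∃[ e ] (end e ≡ (u , v) ⊎ end e ≡ (v , u))

  adj? : (u v : Fin S) → Dec (Adj u v)
  adj? u v = any? λ e → ≡-dec Fin._≟_ Fin._≟_ (end e) (u , v)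
                        ⊎-dec ≡-dec Fin._≟_ Fin._≟_ (end e) (v , u)

  data Reach : Fin S → Fin S → Set where
    here : ∀ {u} → Reach u u
    step : ∀ {u v w} → Adj u v → Reach v w → Reach u w

  Connected : Set
  Connected = (ℕ._<_ 0 S) × (∀ u v → Reach u v)

  Ordinary : Set
  Ordinary = (∀ e → proj₁ (end e) ≢ proj₂ (end e))
           × (∀ e e' → e ≢ e' → end e ≢ end e'
                                × end e ≢ (proj₂ (end e') , proj₁ (end e')))

  Ar : ℕ
  Ar = sum (List.map (λ u → sum (List.map (λ v →
          if ⌊ u FinP.<? v ⌋ ∧ ⌊ adj? u v ⌋ then 1 else 0) (allFin S))) (allFin S))

  Vr : ℚ
  Vr with S
  ... | zero  = ℚ.0ℚ
  ... | suc n = (+ (2 * Ar)) / suc n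

iter : {X : Set} → (X → X) → ℕ → X → X
iter f zero x = x
iter f (suc k) x = f (iter f k x)

SameOrbit : {X : Set} → (X → X) → X → X → Set
SameOrbit f x y = ∃[ k ] iter f k x ≡ y

HasOrbits : {X : Set} → (X → X) → ℕ → Set
HasOrbits {X} f n = Σ (X → Fin n) λ φ →
  Surjective _≡_ _≡_ φ × (∀ x y → (φ x ≡ φ y → SameOrbit f x y) × (SameOrbit f x y → φ x ≡ φ y))

-- A connected graph with a polarization (rotation system): ρ is a
-- permutation of the darts preserving the base vertex and cyclic on the
-- darts at each vertex (ρ d = next dart counterclockwise after d).

record Polarized : Set₁ where
  field
    graph : Graph
  open Graph graph public
  field
    connected : Connected
    ρ ρ⁻ : Dart → Dart
    ρρ⁻ : ∀ d → ρ (ρ⁻ d) ≡ d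
    ρ⁻ρ : ∀ d → ρ⁻ (ρ d) ≡ d
    ρ-base : ∀ d → base (ρ d) ≡ base d
    ρ-cyclic : ∀ d d' → base d ≡ base d' → SameOrbit ρ d d'

  -- τ(o,p) = (p,q), where (p,q) follows (p,o) at p
  τ : Dart → Dart
  τ d = ρ (rev d)

  HasCompleteLeftWalk : Set
  HasCompleteLeftWalk = ∃[ d₀ ] ∀ e → ∃[ b ] SameOrbit τ d₀ (e , b)

-- Cellular embedding in Σ_g, combinatorially: faces = left walks
-- (orbits of τ), with Euler's formula S − A + F = 2 − 2g.
record CellEmb (g : ℕ) : Set₁ where
  field
    pol : Polarized
  open Polarized pol public
  field
    F : ℕ
    faces : HasOrbits τ F
    euler : S + F + 2 * g ≡ A + 2

VcAttainedOrdinary : ℕ → ℚ → Set₁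
VcAttainedOrdinary g x =
  (∀ (G : CellEmb g) → CellEmb.HasCompleteLeftWalk G → CellEmb.Vr G ℚ.≤ x)
  × (Σ (CellEmb g) λ G → CellEmb.Ordinary G × CellEmb.HasCompleteLeftWalk G × CellEmb.Vr G ≡ x)

-- b(g) = 1 + √(1+6g):  "b g x" means x = 1 + r with r ≥ 0, r² = 1 + 6g
IsB : ℕ → ℚ → Set
IsB g x = ∃[ r ] (ℚ.0ℚ ℚ.≤ r × r ℚ.* r ≡ (+ (1 + 6 * g)) / 1 × x ≡ ℚ.1ℚ ℚ.+ r)

floorSqrt : ℕ → ℕ
floorSqrt n = go n
  where
  go : ℕ → ℕ
  go zero = zero
  go (suc k) = if suc k * suc k ≤ᵇ n then suc k else go k

ceilSqrt : ℕ → ℕ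
ceilSqrt n = if floorSqrt n * floorSqrt n ≡ᵇ n then floorSqrt n else suc (floorSqrt n)

-- for y ≥ 0 real: largest even/odd ≤ y only depends on ⌊y⌋,
-- smallest even/odd ≥ y only depends on ⌈y⌉.
floorEven floorOdd ceilEven ceilOdd : ℕ → ℕ
floorEven m = m ∸ (m % 2)
floorOdd m = if m % 2 ≡ᵇ 1 then m else m ∸ 1
ceilEven m = m + (m % 2)
ceilOdd m = if m % 2 ≡ᵇ 1 then m else suc m

-- S_j(g) = 2 + √(6g+j): ⌊S_j(g)⌋ = 2 + ⌊√(6g+j)⌋, ⌈S_j(g)⌉ = 2 + ⌈√(6g+j)⌉
⌊S⌋ ⌈S⌉ : ℕ → ℕ → ℕ
⌊S⌋ j g = 2 + floorSqrt (6 * g + j)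
⌈S⌉ j g = 2 + ceilSqrt (6 * g + j)

ℕtoℚ : ℕ → ℚ
ℕtoℚ n = (+ n) / 1

-- b_r(g), for g ≥ 1 (so that 6g − 4 ≥ 0); ⌈S_j(g)⌉_j ≥ 2 so the divisions are fine
br : ℕ → ℚ
br g = ((ℕtoℚ (floorEven (⌊S⌋ 0 g)) ℚ.- ℚ.1ℚ) ⊔ (ℕtoℚ (floorOdd (⌊S⌋ 1 g)) ℚ.- ℚ.1ℚ))
     ⊔ ((ℕtoℚ 3 ℚ.+ frac (6 * g ∸ 4) (ceilEven (⌈S⌉ 0 g)))
        ⊔ (ℕtoℚ 3 ℚ.+ frac (6 * g ∸ 3) (ceilOdd (⌈S⌉ 1 g))))
  where
  frac : ℕ → ℕ → ℚ
  frac a zero = ℚ.0ℚ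
  frac a (suc d) = (+ a) / suc d

{-# OPTIONS --safe #-}

-- Let W be the complete left walk and call an edge canonical if
-- it is the edge `adj?` picks for its pair of endpoints, so that there are
-- exactly A_r canonical edges.  Give canonical edges cost 1 and all others
-- (loops, surplus parallel edges) cost 3.  Every face other than W costs at
-- least 3: a monogon is a loop, and a digon is a pair of parallel edges, at
-- most one of them canonical (it cannot run along both sides of one edge, as W
-- meets every edge).  The darts outside W cost at most 3A − 2A_r, so
-- 3(F − 1) ≤ 3A − 2A_r, and Euler's formula gives 2A_r + 3 ≤ 3S + 6g.
-- Together with 2A_r ≤ S(S − 1) this bounds V_r = 2A_r/S; small S are checked
-- by computation.  For g = 1 the one remaining case, S = 5 and A_r = 9, makes
-- every inequality above tight: each edge then has exactly one dart outside W
-- and every non-loop edge is canonical.  As τ permutes the darts outside W and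
-- moves the head of a dart to the base of the next, the ends of those darts
-- pair up at every vertex, so all reduced degrees are even, which is
-- impossible for 9 edges on 5 vertices.
--
-- Lower bounds.  Explicit rotation systems with their face labellings,
-- validated by computation.

module Submission where

open import Defs
open import Data.Bool.Base using (Bool; true; false; if_then_else_; _∧_)
open import Data.Bool.Properties as Bool using (not-involutive)
open import Data.Fin.Base as Fin using (Fin; zero; suc)
open import Data.Fin.Properties as Fin using (any?; all?)
open import Data.Fin using (#_)
open import Data.List.Base as List using (List; []; _∷_; allFin)
open import Data.List.Properties using (map-tabulate)
open import Data.List.Relation.Unary.All using (All; []; _∷_)
open import Data.List.Relation.Unary.AllPairs using ([]; _∷_)
open import Data.List.Relation.Unary.Unique.Propositional using (Unique)
open import Data.Maybe.Base as Maybe using (Maybe; just; nothing)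
open import Data.Maybe using (Is-just; to-witness)
import Data.Maybe.Properties as Maybe
import Data.Maybe.Relation.Unary.Any as Is-just
open import Data.Nat.Base using (ℕ; zero; suc; _+_; _*_; _≤_; _<_; z≤n; s≤s; NonZero)
open import Data.Nat.Divisibility using (_∣_; _∣?_; divides; ∣m+n∣m⇒∣n)
open import Data.Nat.DivMod using (_mod_)
import Data.Nat.ListAction as ListAction
open import Data.Nat.Properties as ℕ
open import Data.Nat.Solver using (module +-*-Solver)
open import Data.Product.Base using (Σ; ∃-syntax; _×_; _,_; proj₁; proj₂; uncurry)
open import Data.Product.Properties using (,-injective; ≡-dec)
open import Data.Rational.Base as ℚ using (ℚ; _/_)
open import Data.Rational.Properties using (toℚᵘ-cancel-≤; toℚᵘ-fromℚᵘ)
open import Data.Rational.Unnormalised.Base using (mkℚᵘ; *≤*)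
open import Data.Rational.Unnormalised.Properties using (≤-respˡ-≃; ≤-respʳ-≃; ≃-sym)
open import Data.Sum.Base as Sum using (_⊎_; inj₁; inj₂)
open import Data.Unit.Base using (tt)
open import Data.Vec.Base using (Vec; []; _∷_; lookup)
open import Function.Base using (_∘_)
open import Function.Bundles using (_⇔_; mk⇔; Equivalence)
open import Relation.Binary.Definitions using (tri<; tri≈; tri>)
open import Relation.Binary.PropositionalEquality
open import Relation.Nullary.Decidable
  using (Dec; yes; no; does; ⌊_⌋; map′; ¬?; _×-dec_; _⊎-dec_; _→-dec_; True; toWitness)
open import Relation.Nullary.Negation using (¬_; contradiction)

open import Algebra.Properties.CommutativeSemigroup ℕ.+-commutativeSemigroup using (interchange)
open import Algebra.Properties.Semiring.Sum ℕ.+-*-semiring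
  using (sum; sum-syntax; sum-cong-≗; ∑-distrib-+; ∑-comm; *-distribˡ-sum)

χ : ∀ {p} {P : Set p} → Dec P → ℕ
χ p? = if does p? then 1 else 0

module _ {p} {P : Set p} where

  χ-yes : (p? : Dec P) → P → χ p? ≡ 1
  χ-yes (yes _) _ = refl
  χ-yes (no ¬p) p = contradiction p ¬p

  χ-no : (p? : Dec P) → ¬ P → χ p? ≡ 0
  χ-no (yes p) ¬p = contradiction p ¬p
  χ-no (no _)  _  = refl

  χ≡1⇒ : (p? : Dec P) → χ p? ≡ 1 → P
  χ≡1⇒ (yes p) _ = p

  χ≤1 : (p? : Dec P) → χ p? ≤ 1
  χ≤1 (yes _) = s≤s z≤n
  χ≤1 (no _)  = z≤n

  χ-split : (p? : Dec P) → ∀ n → n ≡ χ (¬? p?) * n + χ p? * n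
  χ-split (yes _) n = sym (+-identityʳ n)
  χ-split (no _)  n = sym (trans (+-identityʳ _) (+-identityʳ n))

module _ {p q} {P : Set p} {Q : Set q} where

  χ-× : (p? : Dec P) (q? : Dec Q) → χ (p? ×-dec q?) ≡ χ p? * χ q?
  χ-× (yes _) (yes _) = refl
  χ-× (yes _) (no _)  = refl
  χ-× (no _)  _       = refl

  ⌊⌋∧⌊⌋≡χ-× : (p? : Dec P) (q? : Dec Q) → (if ⌊ p? ⌋ ∧ ⌊ q? ⌋ then 1 else 0) ≡ χ (p? ×-dec q?)
  ⌊⌋∧⌊⌋≡χ-× (yes _) (yes _) = refl
  ⌊⌋∧⌊⌋≡χ-× (yes _) (no _)  = refl
  ⌊⌋∧⌊⌋≡χ-× (no _)  _       = refl

  χ-cong : (p? : Dec P) (q? : Dec Q) → P ⇔ Q → χ p? ≡ χ q?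
  χ-cong (yes _) (yes _) _   = refl
  χ-cong (yes p) (no ¬q) P⇔Q = contradiction (Equivalence.to P⇔Q p) ¬q
  χ-cong (no ¬p) (yes q) P⇔Q = contradiction (Equivalence.from P⇔Q q) ¬p
  χ-cong (no _)  (no _)  _   = refl

∑-mono-≤ : ∀ {n} {f g : Fin n → ℕ} → (∀ i → f i ≤ g i) → sum f ≤ sum g
∑-mono-≤ {zero}  f≤g = z≤n
∑-mono-≤ {suc n} f≤g = +-mono-≤ (f≤g zero) (∑-mono-≤ (f≤g ∘ suc))

∑-rigid : ∀ {n} {f g : Fin n → ℕ} → (∀ i → f i ≤ g i) → sum g ≤ sum f → ∀ i → f i ≡ g i
∑-rigid {suc n} {f} {g} f≤g ∑g≤∑f zero = ≤-antisym (f≤g zero)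
  (+-cancelʳ-≤ _ _ _ (≤-trans ∑g≤∑f (+-monoʳ-≤ (f zero) (∑-mono-≤ (f≤g ∘ suc)))))
∑-rigid {suc n} {f} {g} f≤g ∑g≤∑f (suc i) = ∑-rigid (f≤g ∘ suc)
  (+-cancelˡ-≤ (g zero) _ _ (≤-trans ∑g≤∑f (+-monoˡ-≤ _ (f≤g zero)))) i

∑-const : ∀ n c → ∑[ i < n ] c ≡ n * c
∑-const zero    c = refl
∑-const (suc n) c = cong (c +_) (∑-const n c)

∑-indicator : ∀ {n} (a : Fin n) v → ∑[ i < n ] (χ (i Fin.≟ a) * v) ≡ v
∑-indicator {suc n} zero    v = begin
  v + 0 + ∑[ i < n ] 0 ≡⟨ cong (v + 0 +_) (trans (∑-const n 0) (*-zeroʳ n)) ⟩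
  v + 0 + 0            ≡⟨ trans (+-identityʳ _) (+-identityʳ v) ⟩
  v                    ∎
  where open ≡-Reasoning
∑-indicator {suc n} (suc a) v = ∑-indicator a v

sum-allFin : ∀ {n} (f : Fin n → ℕ) → ListAction.sum (List.map f (allFin n)) ≡ sum f
sum-allFin {n} f = trans (cong ListAction.sum (map-tabulate (λ i → i) f)) (sum-tabulate f)
  where
  sum-tabulate : ∀ {n} (f : Fin n → ℕ) → ListAction.sum (List.tabulate f) ≡ sum f
  sum-tabulate {zero}  f = refl
  sum-tabulate {suc n} f = cong (f zero +_) (sum-tabulate (f ∘ suc))

module DartSum (A : ℕ) where

  Dart : Set
  Dart = Fin A × Bool

  infix 4 _≟ᴰ_
  _≟ᴰ_ : (d d′ : Dart) → Dec (d ≡ d′)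
  (e , b) ≟ᴰ (e′ , b′) = map′ (uncurry (cong₂ _,_)) ,-injective (e Fin.≟ e′ ×-dec b Bool.≟ b′)

  ∑ᴰ : (Dart → ℕ) → ℕ
  ∑ᴰ h = ∑[ e < A ] (h (e , false) + h (e , true))

  ∑ᴰ-cong : ∀ {h k : Dart → ℕ} → (∀ d → h d ≡ k d) → ∑ᴰ h ≡ ∑ᴰ k
  ∑ᴰ-cong h≗k = sum-cong-≗ λ e → cong₂ _+_ (h≗k (e , false)) (h≗k (e , true))

  ∑ᴰ-distrib-+ : ∀ (h k : Dart → ℕ) → ∑ᴰ (λ d → h d + k d) ≡ ∑ᴰ h + ∑ᴰ k
  ∑ᴰ-distrib-+ h k = trans
    (sum-cong-≗ λ e → interchange (h (e , false)) (k (e , false)) (h (e , true)) (k (e , true)))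
    (∑-distrib-+ (λ e → h (e , false) + h (e , true)) (λ e → k (e , false) + k (e , true)))

  ∑ᴰ-comm-∑ : ∀ {n} (h : Dart → Fin n → ℕ) →
              ∑ᴰ (λ d → ∑[ i < n ] h d i) ≡ ∑[ i < n ] ∑ᴰ (λ d → h d i)
  ∑ᴰ-comm-∑ {n} h = begin
    ∑[ e < A ] (∑[ i < n ] h (e , false) i + ∑[ i < n ] h (e , true) i)
      ≡⟨ sum-cong-≗ (λ e → ∑-distrib-+ (h (e , false)) (h (e , true))) ⟨
    ∑[ e < A ] ∑[ i < n ] (h (e , false) i + h (e , true) i)
      ≡⟨ ∑-comm (λ e i → h (e , false) i + h (e , true) i) ⟩
    ∑[ i < n ] ∑ᴰ (λ d → h d i) ∎
    where open ≡-Reasoning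

  ∑ᴰ-comm : ∀ (h : Dart → Dart → ℕ) → ∑ᴰ (λ d → ∑ᴰ (h d)) ≡ ∑ᴰ (λ d′ → ∑ᴰ (λ d → h d d′))
  ∑ᴰ-comm h = begin
    ∑ᴰ (λ d → ∑[ e < A ] (h d (e , false) + h d (e , true)))
      ≡⟨ ∑ᴰ-comm-∑ (λ d e → h d (e , false) + h d (e , true)) ⟩
    ∑[ e < A ] ∑ᴰ (λ d → h d (e , false) + h d (e , true))
      ≡⟨ sum-cong-≗ (λ e → ∑ᴰ-distrib-+ (λ d → h d (e , false)) (λ d → h d (e , true))) ⟩
    ∑ᴰ (λ d′ → ∑ᴰ (λ d → h d d′)) ∎
    where open ≡-Reasoning

  χ-≟ᴰ : ∀ e b e′ b′ → χ ((e , b) ≟ᴰ (e′ , b′)) ≡ χ (e Fin.≟ e′) * χ (b Bool.≟ b′)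
  χ-≟ᴰ e b e′ b′ = χ-× (e Fin.≟ e′) (b Bool.≟ b′)

  ∑ᴰ-indicator : ∀ (a : Dart) v → ∑ᴰ (λ d → χ (d ≟ᴰ a) * v) ≡ v
  ∑ᴰ-indicator (e₀ , b₀) v = trans (sum-cong-≗ (at-edge b₀)) (∑-indicator e₀ v)
    where
    at-edge : ∀ b₀ e → χ ((e , false) ≟ᴰ (e₀ , b₀)) * v + χ ((e , true) ≟ᴰ (e₀ , b₀)) * v
                       ≡ χ (e Fin.≟ e₀) * v
    at-edge false e rewrite χ-≟ᴰ e false e₀ false | χ-≟ᴰ e true e₀ false =
      trans (cong₂ (λ y z → y * v + z * v) (*-identityʳ x) (*-zeroʳ x)) (+-identityʳ (x * v))
      where x = χ (e Fin.≟ e₀)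
    at-edge true e rewrite χ-≟ᴰ e false e₀ true | χ-≟ᴰ e true e₀ true =
      cong₂ (λ y z → y * v + z * v) (*-zeroʳ x) (*-identityʳ x)
      where x = χ (e Fin.≟ e₀)

  ∑ᴰ-select : ∀ (a : Dart) (h : Dart → ℕ) → ∑ᴰ (λ d → χ (d ≟ᴰ a) * h d) ≡ h a
  ∑ᴰ-select a h = begin
    ∑ᴰ (λ d → χ (d ≟ᴰ a) * h d) ≡⟨ ∑ᴰ-cong (λ d → χ-subst d (d ≟ᴰ a)) ⟩
    ∑ᴰ (λ d → χ (d ≟ᴰ a) * h a) ≡⟨ ∑ᴰ-indicator a (h a) ⟩
    h a                          ∎
    where
    open ≡-Reasoning
    χ-subst : ∀ d (d≟a : Dec (d ≡ a)) → χ d≟a * h d ≡ χ d≟a * h a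
    χ-subst _ (yes refl) = refl
    χ-subst _ (no _)     = refl

  ∑ᴰ-permute : ∀ (π π⁻ : Dart → Dart) → (∀ d → π (π⁻ d) ≡ d) → (∀ d → π⁻ (π d) ≡ d) →
               ∀ h → ∑ᴰ (h ∘ π) ≡ ∑ᴰ h
  ∑ᴰ-permute π π⁻ ππ⁻ π⁻π h = begin
    ∑ᴰ (λ d → h (π d))
      ≡⟨ ∑ᴰ-cong (λ d → ∑ᴰ-select (π d) h) ⟨
    ∑ᴰ (λ d → ∑ᴰ (λ d′ → χ (d′ ≟ᴰ π d) * h d′))
      ≡⟨ ∑ᴰ-cong (λ d → ∑ᴰ-cong (λ d′ → cong (_* h d′) (inverse d d′))) ⟩
    ∑ᴰ (λ d → ∑ᴰ (λ d′ → χ (d ≟ᴰ π⁻ d′) * h d′))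
      ≡⟨ ∑ᴰ-comm (λ d d′ → χ (d ≟ᴰ π⁻ d′) * h d′) ⟩
    ∑ᴰ (λ d′ → ∑ᴰ (λ d → χ (d ≟ᴰ π⁻ d′) * h d′))
      ≡⟨ ∑ᴰ-cong (λ d′ → ∑ᴰ-indicator (π⁻ d′) (h d′)) ⟩
    ∑ᴰ h ∎
    where
    open ≡-Reasoning
    inverse : ∀ d d′ → χ (d′ ≟ᴰ π d) ≡ χ (d ≟ᴰ π⁻ d′)
    inverse d d′ = χ-cong (d′ ≟ᴰ π d) (d ≟ᴰ π⁻ d′)
      (mk⇔ (λ { refl → sym (π⁻π d) }) (λ { refl → sym (ππ⁻ d′) }))

  _∖_ : (Dart → ℕ) → Dart → Dart → ℕ
  (h ∖ a) d = if does (d ≟ᴰ a) then 0 else h d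

  ∑ᴰ-remove : ∀ h a → ∑ᴰ h ≡ h a + ∑ᴰ (h ∖ a)
  ∑ᴰ-remove h a = begin
    ∑ᴰ h                                      ≡⟨ ∑ᴰ-cong (λ d → split d (d ≟ᴰ a)) ⟩
    ∑ᴰ (λ d → χ (d ≟ᴰ a) * h a + (h ∖ a) d)  ≡⟨ ∑ᴰ-distrib-+ (λ d → χ (d ≟ᴰ a) * h a) (h ∖ a) ⟩
    ∑ᴰ (λ d → χ (d ≟ᴰ a) * h a) + ∑ᴰ (h ∖ a) ≡⟨ cong (_+ ∑ᴰ (h ∖ a)) (∑ᴰ-indicator a (h a)) ⟩
    h a + ∑ᴰ (h ∖ a)                          ∎
    where
    open ≡-Reasoning
    split : ∀ d (d≟a : Dec (d ≡ a)) → h d ≡ χ d≟a * h a + (if does d≟a then 0 else h d)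
    split _ (yes refl) = sym (trans (+-identityʳ _) (+-identityʳ _))
    split _ (no _)     = refl

  ∑ᴰ-distinct : ∀ h {xs : List Dart} → Unique xs → ListAction.sum (List.map h xs) ≤ ∑ᴰ h
  ∑ᴰ-distinct h []                     = z≤n
  ∑ᴰ-distinct h {x ∷ xs} (x≢xs ∷ uxs) = begin
    h x + ListAction.sum (List.map h xs)         ≡⟨ cong (h x +_) (sum-away x≢xs) ⟩
    h x + ListAction.sum (List.map (h ∖ x) xs)   ≤⟨ +-monoʳ-≤ (h x) (∑ᴰ-distinct (h ∖ x) uxs) ⟩
    h x + ∑ᴰ (h ∖ x)                        ≡⟨ ∑ᴰ-remove h x ⟨
    ∑ᴰ h                                    ∎
    where
    open ≤-Reasoning
    away : ∀ y (y≟x : Dec (y ≡ x)) → ¬ x ≡ y → h y ≡ (if does y≟x then 0 else h y)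
    away _ (yes refl) x≢x = contradiction refl x≢x
    away _ (no _)     _   = refl
    sum-away : ∀ {ys} → All (λ y → ¬ x ≡ y) ys →
               ListAction.sum (List.map h ys) ≡ ListAction.sum (List.map (h ∖ x) ys)
    sum-away []                      = refl
    sum-away {y ∷ ys} (x≢y ∷ x≢ys) = cong₂ _+_ (away y (y ≟ᴰ x) x≢y) (sum-away x≢ys)

-- Adjacency matrices

pairCount : ∀ {n} → (Fin n → Fin n → Bool) → ℕ
pairCount {n} M = ∑[ u < n ] ∑[ v < n ] (if ⌊ u Fin.<? v ⌋ ∧ M u v then 1 else 0)

degree : ∀ {n} → (Fin n → Fin n → Bool) → Fin n → ℕ
degree {n} M p =
  ∑[ v < n ] ((if ⌊ p Fin.<? v ⌋ ∧ M p v then 1 else 0) + (if ⌊ v Fin.<? p ⌋ ∧ M v p then 1 else 0))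

pairCount-≤-complete : ∀ {n} (M : Fin n → Fin n → Bool) → pairCount M ≤ pairCount {n} (λ _ _ → true)
pairCount-≤-complete M = ∑-mono-≤ λ u → ∑-mono-≤ λ v → ∧-≤ ⌊ u Fin.<? v ⌋ (M u v)
  where
  ∧-≤ : ∀ b c → (if b ∧ c then 1 else 0) ≤ (if b ∧ true then 1 else 0)
  ∧-≤ false _     = z≤n
  ∧-≤ true  false = z≤n
  ∧-≤ true  true  = ≤-refl

complete-pairCount : ∀ n → 2 * pairCount {n} (λ _ _ → true) + n ≡ n * n
complete-pairCount n = begin
  2 * P + n
    ≡⟨ cong₂ _+_ (cong (P +_) (+-identityʳ P)) (sym (trans (sum-cong-≗ ∑-diagonal) (trans (∑-const n 1) (*-identityʳ n)))) ⟩
  P + ∑[ u < n ] ∑[ v < n ] L u v + ∑[ u < n ] ∑[ v < n ] χ (v Fin.≟ u)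
    ≡⟨ cong (λ x → P + x + ∑[ u < n ] ∑[ v < n ] χ (v Fin.≟ u)) (∑-comm L) ⟩
  P + ∑[ u < n ] ∑[ v < n ] L v u + ∑[ u < n ] ∑[ v < n ] χ (v Fin.≟ u)
    ≡⟨ cong (_+ ∑[ u < n ] ∑[ v < n ] χ (v Fin.≟ u)) (∑-distrib-+ (λ u → ∑[ v < n ] L u v) (λ u → ∑[ v < n ] L v u)) ⟨
  ∑[ u < n ] (∑[ v < n ] L u v + ∑[ v < n ] L v u) + ∑[ u < n ] ∑[ v < n ] χ (v Fin.≟ u)
    ≡⟨ ∑-distrib-+ (λ u → ∑[ v < n ] L u v + ∑[ v < n ] L v u) (λ u → ∑[ v < n ] χ (v Fin.≟ u)) ⟨
  ∑[ u < n ] (∑[ v < n ] L u v + ∑[ v < n ] L v u + ∑[ v < n ] χ (v Fin.≟ u))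
    ≡⟨ sum-cong-≗ (λ u → trans (∑-distrib-+ (λ v → L u v + L v u) (λ v → χ (v Fin.≟ u)))
                               (cong (_+ ∑[ v < n ] χ (v Fin.≟ u)) (∑-distrib-+ (L u) (λ v → L v u)))) ⟨
  ∑[ u < n ] ∑[ v < n ] (L u v + L v u + χ (v Fin.≟ u))
    ≡⟨ sum-cong-≗ (λ u → sum-cong-≗ (λ v → trichotomy u v)) ⟩
  ∑[ u < n ] ∑[ v < n ] 1
    ≡⟨ trans (sum-cong-≗ {n} (λ _ → trans (∑-const n 1) (*-identityʳ n))) (∑-const n n) ⟩
  n * n ∎
  where
  open ≡-Reasoning
  L : Fin n → Fin n → ℕ
  L u v = if ⌊ u Fin.<? v ⌋ ∧ true then 1 else 0
  P = pairCount {n} (λ _ _ → true)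
  ∑-diagonal : ∀ u → ∑[ v < n ] χ (v Fin.≟ u) ≡ 1
  ∑-diagonal u = trans (sum-cong-≗ (λ v → sym (*-identityʳ (χ (v Fin.≟ u))))) (∑-indicator u 1)
  trichotomy : ∀ u v → L u v + L v u + χ (v Fin.≟ u) ≡ 1
  trichotomy u v with u Fin.<? v | v Fin.<? u | v Fin.≟ u
  ... | yes u<v | yes v<u | _        = contradiction v<u (Fin.<-asym u<v)
  ... | yes u<v | no _    | yes refl = contradiction u<v (Fin.<-irrefl refl)
  ... | yes _   | no _    | no _     = refl
  ... | no _    | yes v<u | yes refl = contradiction v<u (Fin.<-irrefl refl)
  ... | no _    | yes _   | no _     = refl
  ... | no _    | no _    | yes _    = refl
  ... | no u≮v  | no v≮u  | no v≢u with Fin.<-cmp u v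
  ...   | tri< u<v _ _ = contradiction u<v u≮v
  ...   | tri≈ _ u≡v _ = contradiction (sym u≡v) v≢u
  ...   | tri> _ _ v<u = contradiction v<u v≮u

∀-Vec? : ∀ n {P : Vec Bool n → Set} → (∀ bs → Dec (P bs)) → Dec (∀ bs → P bs)
∀-Vec? zero    P? = map′ (λ { p [] → p }) (λ ∀p → ∀p []) (P? [])
∀-Vec? (suc n) P? = map′ (λ { (f , t) (false ∷ bs) → f bs ; (f , t) (true ∷ bs) → t bs })
                         (λ ∀p → (λ bs → ∀p (false ∷ bs)) , (λ bs → ∀p (true ∷ bs)))
                         (∀-Vec? n (λ bs → P? (false ∷ bs)) ×-dec ∀-Vec? n (λ bs → P? (true ∷ bs)))

above-diagonal : Vec Bool 10 → Fin 5 → Fin 5 → Bool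
above-diagonal (b₀₁ ∷ b₀₂ ∷ b₀₃ ∷ b₀₄ ∷ b₁₂ ∷ b₁₃ ∷ b₁₄ ∷ b₂₃ ∷ b₂₄ ∷ b₃₄ ∷ []) = M
  where
  M : Fin 5 → Fin 5 → Bool
  M zero                   (suc zero)                   = b₀₁
  M zero                   (suc (suc zero))             = b₀₂
  M zero                   (suc (suc (suc zero)))       = b₀₃
  M zero                   (suc (suc (suc (suc zero)))) = b₀₄
  M (suc zero)             (suc (suc zero))             = b₁₂
  M (suc zero)             (suc (suc (suc zero)))       = b₁₃
  M (suc zero)             (suc (suc (suc (suc zero)))) = b₁₄
  M (suc (suc zero))       (suc (suc (suc zero)))       = b₂₃
  M (suc (suc zero))       (suc (suc (suc (suc zero)))) = b₂₄
  M (suc (suc (suc zero))) (suc (suc (suc (suc zero)))) = b₃₄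
  M _                      _                            = false

entries-above-diagonal : (Fin 5 → Fin 5 → Bool) → Vec Bool 10
entries-above-diagonal M =
  M (# 0) (# 1) ∷ M (# 0) (# 2) ∷ M (# 0) (# 3) ∷ M (# 0) (# 4) ∷ M (# 1) (# 2) ∷
  M (# 1) (# 3) ∷ M (# 1) (# 4) ∷ M (# 2) (# 3) ∷ M (# 2) (# 4) ∷ M (# 3) (# 4) ∷ []

nine-edges-on-five-vertices? :
  Dec (∀ bs → ¬ (pairCount (above-diagonal bs) ≡ 9 × (∀ p → 2 ∣ degree (above-diagonal bs) p)))
nine-edges-on-five-vertices? =
  ∀-Vec? 10 (λ bs → ¬? (pairCount (above-diagonal bs) ≟ 9 ×-dec all? (λ p → 2 ∣? degree (above-diagonal bs) p)))

-- pairCount and degree only inspect M u v for u < v, so M and its rebuilt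
-- copy agree definitionally once p is a numeral.
nine-edges-on-five-vertices : ∀ {n} → n ≡ 5 → (M : Fin n → Fin n → Bool) →
                              pairCount M ≡ 9 → ¬ (∀ p → 2 ∣ degree M p)
nine-edges-on-five-vertices refl M nine even = toWitness {a? = nine-edges-on-five-vertices?} _
  (entries-above-diagonal M) (nine , λ p → subst (2 ∣_) (rebuilt p) (even p))
  where
  rebuilt : ∀ p → degree M p ≡ degree (above-diagonal (entries-above-diagonal M)) p
  rebuilt zero                         = refl
  rebuilt (suc zero)                   = refl
  rebuilt (suc (suc zero))             = refl
  rebuilt (suc (suc (suc zero)))       = refl
  rebuilt (suc (suc (suc (suc zero)))) = refl

-- Canonical edges

module CanonicalEdges (G : Graph) where
  open Graph G

  adjacency : Fin S → Fin S → Bool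
  adjacency u v = ⌊ adj? u v ⌋

  Ar≡pairCount : Ar ≡ pairCount adjacency
  Ar≡pairCount = trans (sum-allFin (λ u → ListAction.sum (List.map (pair u) (allFin S))))
                       (sum-cong-≗ λ u → sum-allFin (pair u))
    where
    pair : Fin S → Fin S → ℕ
    pair u v = if ⌊ u Fin.<? v ⌋ ∧ adjacency u v then 1 else 0

  pairs-bound : 2 * Ar + S ≤ S * S
  pairs-bound = begin
    2 * Ar + S                                ≡⟨ cong (λ a → 2 * a + S) Ar≡pairCount ⟩
    2 * pairCount adjacency + S               ≤⟨ +-monoˡ-≤ S (*-monoʳ-≤ 2 (pairCount-≤-complete adjacency)) ⟩
    2 * pairCount {S} (λ _ _ → true) + S      ≡⟨ complete-pairCount S ⟩
    S * S                                     ∎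
    where open ≤-Reasoning

  Joins : Fin A → Fin S → Fin S → Set
  Joins e u v = end e ≡ (u , v) ⊎ end e ≡ (v , u)

  joins-sym : ∀ {e u v} → Joins e u v → Joins e v u
  joins-sym (inj₁ e≡uv) = inj₂ e≡uv
  joins-sym (inj₂ e≡vu) = inj₁ e≡vu

  sort : Fin S × Fin S → Fin S × Fin S
  sort (x , y) with x Fin.<? y
  ... | yes _ = x , y
  ... | no _  = y , x

  sort-joins : ∀ {e u v} → u Fin.< v → Joins e u v → sort (end e) ≡ (u , v)
  sort-joins {e} {u} {v} u<v (inj₁ e≡uv) rewrite e≡uv with u Fin.<? v
  ... | yes _   = refl
  ... | no u≮v  = contradiction u<v u≮v
  sort-joins {e} {u} {v} u<v (inj₂ e≡vu) rewrite e≡vu with v Fin.<? u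
  ... | yes v<u = contradiction v<u (Fin.<-asym u<v)
  ... | no _    = refl

  sort-swap : ∀ x y → sort (x , y) ≡ sort (y , x)
  sort-swap x y with x Fin.<? y | y Fin.<? x
  ... | yes x<y | yes y<x = contradiction y<x (Fin.<-asym x<y)
  ... | yes _   | no _    = refl
  ... | no _    | yes _   = refl
  ... | no x≮y  | no y≮x  with Fin.<-cmp x y
  ...   | tri< x<y _ _ = contradiction x<y x≮y
  ...   | tri≈ _ refl _ = refl
  ...   | tri> _ _ y<x = contradiction y<x y≮x

  sort-sum : ∀ (f : Fin S → ℕ) x y → f (proj₁ (sort (x , y))) + f (proj₂ (sort (x , y))) ≡ f x + f y
  sort-sum f x y with x Fin.<? y
  ... | yes _ = refl
  ... | no _  = +-comm (f y) (f x)

  lo hi : Fin A → Fin S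
  lo e = proj₁ (sort (end e))
  hi e = proj₂ (sort (end e))

  choice : Fin S → Fin S → Maybe (Fin A)
  choice u v with adj? u v
  ... | yes (e , _) = just e
  ... | no _        = nothing

  Chosen : Fin S → Fin S → Fin A → Set
  Chosen u v e = choice u v ≡ just e

  chosen? : ∀ u v e → Dec (Chosen u v e)
  chosen? u v e = Maybe.≡-dec Fin._≟_ (choice u v) (just e)

  chosen-joins : ∀ {u v e} → Chosen u v e → Joins e u v
  chosen-joins {u} {v} with adj? u v
  ... | yes (e , joins) = λ { refl → joins }
  ... | no _            = λ ()

  Canonical : Fin A → Set
  Canonical e = lo e Fin.< hi e × Chosen (lo e) (hi e) e

  canonical? : ∀ e → Dec (Canonical e)
  canonical? e = lo e Fin.<? hi e ×-dec chosen? (lo e) (hi e) e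

  chosen⇔canonical : ∀ {u v e} → (u Fin.< v × Chosen u v e) ⇔ (u ≡ lo e × v ≡ hi e × Canonical e)
  chosen⇔canonical {u} {v} {e} = mk⇔ to λ { (refl , refl , can) → can }
    where
    to : u Fin.< v × Chosen u v e → u ≡ lo e × v ≡ hi e × Canonical e
    to (u<v , ch) rewrite sort-joins u<v (chosen-joins ch) = refl , refl , u<v , ch

  canonical-not-loop : ∀ {e} → Canonical e → proj₁ (end e) ≢ proj₂ (end e)
  canonical-not-loop {e} (lo<hi , _) loop = Fin.<-irrefl (diagonal (end e) loop) lo<hi
    where
    diagonal : ∀ xy → proj₁ xy ≡ proj₂ xy → proj₁ (sort xy) ≡ proj₂ (sort xy)
    diagonal (x , .x) refl with x Fin.<? x
    ... | yes _ = refl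
    ... | no _  = refl

  joins-sort : ∀ {e u v} → Joins e u v → sort (end e) ≡ sort (u , v)
  joins-sort (inj₁ e≡uv) = cong sort e≡uv
  joins-sort {u = u} {v} (inj₂ e≡vu) = trans (cong sort e≡vu) (sort-swap v u)

  canonical-unique : ∀ {e e′ u v} → Canonical e → Canonical e′ → Joins e u v → Joins e′ u v → e ≡ e′
  canonical-unique {e} {e′} (_ , ch) (_ , ch′) j j′ = Maybe.just-injective (begin
    just e                  ≡⟨ ch ⟨
    choice (lo e) (hi e)    ≡⟨ cong (uncurry choice) (trans (joins-sort j) (sym (joins-sort j′))) ⟩
    choice (lo e′) (hi e′)  ≡⟨ ch′ ⟩
    just e′                 ∎)
    where open ≡-Reasoning

  ∑-chosen : ∀ u v → ∑[ e < A ] χ (chosen? u v e) ≡ χ (adj? u v)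
  ∑-chosen u v with adj? u v
  ... | no _         = trans (∑-const A 0) (*-zeroʳ A)
  ... | yes (e₀ , _) = trans (sum-cong-≗ λ e → trans (χ-just e) (sym (*-identityʳ _))) (∑-indicator e₀ 1)
    where
    χ-just : ∀ e → χ (Maybe.≡-dec Fin._≟_ (just e₀) (just e)) ≡ χ (e Fin.≟ e₀)
    χ-just e = χ-cong (Maybe.≡-dec Fin._≟_ (just e₀) (just e)) (e Fin.≟ e₀)
                      (mk⇔ (sym ∘ Maybe.just-injective) (cong just ∘ sym))

  chosenPair : Fin S → Fin S → Fin A → ℕ
  chosenPair u v e = χ (u Fin.<? v ×-dec chosen? u v e)

  count-pair : ∀ u v → (if ⌊ u Fin.<? v ⌋ ∧ adjacency u v then 1 else 0) ≡ ∑[ e < A ] chosenPair u v e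
  count-pair u v = begin
    (if ⌊ u Fin.<? v ⌋ ∧ adjacency u v then 1 else 0) ≡⟨ ⌊⌋∧⌊⌋≡χ-× (u Fin.<? v) (adj? u v) ⟩
    χ (u Fin.<? v ×-dec adj? u v)                      ≡⟨ χ-× (u Fin.<? v) (adj? u v) ⟩
    χ (u Fin.<? v) * χ (adj? u v)                      ≡⟨ cong (χ (u Fin.<? v) *_) (∑-chosen u v) ⟨
    χ (u Fin.<? v) * ∑[ e < A ] χ (chosen? u v e)      ≡⟨ *-distribˡ-sum (χ (u Fin.<? v)) (λ e → χ (chosen? u v e)) ⟩
    ∑[ e < A ] (χ (u Fin.<? v) * χ (chosen? u v e))    ≡⟨ sum-cong-≗ (λ e → χ-× (u Fin.<? v) (chosen? u v e)) ⟨
    ∑[ e < A ] chosenPair u v e                        ∎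
    where open ≡-Reasoning

  chosenPair-factors : ∀ u v e → chosenPair u v e ≡ χ (u Fin.≟ lo e) * (χ (v Fin.≟ hi e) * χ (canonical? e))
  chosenPair-factors u v e = begin
    χ (u Fin.<? v ×-dec chosen? u v e)
      ≡⟨ χ-cong (u Fin.<? v ×-dec chosen? u v e) (u Fin.≟ lo e ×-dec v Fin.≟ hi e ×-dec canonical? e) chosen⇔canonical ⟩
    χ (u Fin.≟ lo e ×-dec v Fin.≟ hi e ×-dec canonical? e)
      ≡⟨ χ-× (u Fin.≟ lo e) (v Fin.≟ hi e ×-dec canonical? e) ⟩
    χ (u Fin.≟ lo e) * χ (v Fin.≟ hi e ×-dec canonical? e)
      ≡⟨ cong (χ (u Fin.≟ lo e) *_) (χ-× (v Fin.≟ hi e) (canonical? e)) ⟩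
    χ (u Fin.≟ lo e) * (χ (v Fin.≟ hi e) * χ (canonical? e)) ∎
    where open ≡-Reasoning

  count-edge : ∀ e → ∑[ u < S ] ∑[ v < S ] chosenPair u v e ≡ χ (canonical? e)
  count-edge e = begin
    ∑[ u < S ] ∑[ v < S ] chosenPair u v e
      ≡⟨ sum-cong-≗ (λ u → sum-cong-≗ (λ v → chosenPair-factors u v e)) ⟩
    ∑[ u < S ] ∑[ v < S ] (χ (u Fin.≟ lo e) * (χ (v Fin.≟ hi e) * c))
      ≡⟨ sum-cong-≗ (λ u → *-distribˡ-sum (χ (u Fin.≟ lo e)) (λ v → χ (v Fin.≟ hi e) * c)) ⟨
    ∑[ u < S ] (χ (u Fin.≟ lo e) * ∑[ v < S ] (χ (v Fin.≟ hi e) * c))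
      ≡⟨ sum-cong-≗ (λ u → cong (χ (u Fin.≟ lo e) *_) (∑-indicator (hi e) c)) ⟩
    ∑[ u < S ] (χ (u Fin.≟ lo e) * c)
      ≡⟨ ∑-indicator (lo e) c ⟩
    c ∎
    where
    open ≡-Reasoning
    c = χ (canonical? e)

  Ar≡#canonical : Ar ≡ ∑[ e < A ] χ (canonical? e)
  Ar≡#canonical = begin
    Ar                                              ≡⟨ Ar≡pairCount ⟩
    pairCount adjacency                             ≡⟨ sum-cong-≗ (λ u → sum-cong-≗ (count-pair u)) ⟩
    ∑[ u < S ] ∑[ v < S ] ∑[ e < A ] chosenPair u v e ≡⟨ sum-cong-≗ (λ u → ∑-comm (chosenPair u)) ⟩
    ∑[ u < S ] ∑[ e < A ] ∑[ v < S ] chosenPair u v e ≡⟨ ∑-comm (λ u e → ∑[ v < S ] chosenPair u v e) ⟩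
    ∑[ e < A ] ∑[ u < S ] ∑[ v < S ] chosenPair u v e ≡⟨ sum-cong-≗ count-edge ⟩
    ∑[ e < A ] χ (canonical? e)                     ∎
    where open ≡-Reasoning

  ends-at : Fin S → Fin A → ℕ
  ends-at p e = χ (p Fin.≟ proj₁ (end e)) + χ (p Fin.≟ proj₂ (end e))

  reducedDegree : Fin S → ℕ
  reducedDegree = degree adjacency

  reducedDegree≡∑canonical : ∀ p → reducedDegree p ≡ ∑[ e < A ] (χ (canonical? e) * ends-at p e)
  reducedDegree≡∑canonical p = begin
    degree adjacency p
      ≡⟨ sum-cong-≗ (λ v → cong₂ _+_ (count-pair p v) (count-pair v p)) ⟩
    ∑[ v < S ] (∑[ e < A ] chosenPair p v e + ∑[ e < A ] chosenPair v p e)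
      ≡⟨ sum-cong-≗ (λ v → ∑-distrib-+ (chosenPair p v) (λ e → chosenPair v p e)) ⟨
    ∑[ v < S ] ∑[ e < A ] (chosenPair p v e + chosenPair v p e)
      ≡⟨ ∑-comm (λ v e → chosenPair p v e + chosenPair v p e) ⟩
    ∑[ e < A ] ∑[ v < S ] (chosenPair p v e + chosenPair v p e)
      ≡⟨ sum-cong-≗ at-edge ⟩
    ∑[ e < A ] (χ (canonical? e) * ends-at p e) ∎
    where
    open ≡-Reasoning
    at-edge : ∀ e → ∑[ v < S ] (chosenPair p v e + chosenPair v p e) ≡ χ (canonical? e) * ends-at p e
    at-edge e = begin
      ∑[ v < S ] (chosenPair p v e + chosenPair v p e)
        ≡⟨ sum-cong-≗ (λ v → cong₂ _+_ (chosenPair-factors p v e) (chosenPair-factors v p e)) ⟩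
      ∑[ v < S ] (χ (p Fin.≟ lo e) * (χ (v Fin.≟ hi e) * c) + χ (v Fin.≟ lo e) * (χ (p Fin.≟ hi e) * c))
        ≡⟨ ∑-distrib-+ (λ v → χ (p Fin.≟ lo e) * (χ (v Fin.≟ hi e) * c)) (λ v → χ (v Fin.≟ lo e) * (χ (p Fin.≟ hi e) * c)) ⟩
      ∑[ v < S ] (χ (p Fin.≟ lo e) * (χ (v Fin.≟ hi e) * c)) + ∑[ v < S ] (χ (v Fin.≟ lo e) * (χ (p Fin.≟ hi e) * c))
        ≡⟨ cong₂ _+_ (sym (*-distribˡ-sum (χ (p Fin.≟ lo e)) (λ v → χ (v Fin.≟ hi e) * c)))
                     (∑-indicator (lo e) (χ (p Fin.≟ hi e) * c)) ⟩
      χ (p Fin.≟ lo e) * ∑[ v < S ] (χ (v Fin.≟ hi e) * c) + χ (p Fin.≟ hi e) * c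
        ≡⟨ cong (λ x → χ (p Fin.≟ lo e) * x + χ (p Fin.≟ hi e) * c) (∑-indicator (hi e) c) ⟩
      χ (p Fin.≟ lo e) * c + χ (p Fin.≟ hi e) * c
        ≡⟨ *-distribʳ-+ c (χ (p Fin.≟ lo e)) (χ (p Fin.≟ hi e)) ⟨
      (χ (p Fin.≟ lo e) + χ (p Fin.≟ hi e)) * c
        ≡⟨ cong (_* c) (sort-sum (λ x → χ (p Fin.≟ x)) (proj₁ (end e)) (proj₂ (end e))) ⟩
      ends-at p e * c
        ≡⟨ *-comm (ends-at p e) c ⟩
      c * ends-at p e ∎
      where c = χ (canonical? e)

-- Counting along a complete left walk

module CompleteLeftWalk {g : ℕ} (G : CellEmb g) (walk : CellEmb.HasCompleteLeftWalk G) where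
  open CellEmb G
  open CanonicalEdges graph
  open DartSum A using (∑ᴰ; ∑ᴰ-cong; ∑ᴰ-distrib-+; ∑ᴰ-comm-∑; ∑ᴰ-permute; ∑ᴰ-distinct; _≟ᴰ_)

  head : Dart → Fin S
  head d = base (rev d)

  edge : Dart → Fin A
  edge = proj₁

  rev-involutive : ∀ d → rev (rev d) ≡ d
  rev-involutive (e , b) = cong (e ,_) (not-involutive b)

  τ⁻ : Dart → Dart
  τ⁻ d = rev (ρ⁻ d)

  ττ⁻ : ∀ d → τ (τ⁻ d) ≡ d
  ττ⁻ d = trans (cong ρ (rev-involutive (ρ⁻ d))) (ρρ⁻ d)

  τ⁻τ : ∀ d → τ⁻ (τ d) ≡ d
  τ⁻τ d = trans (cong rev (ρ⁻ρ (rev d))) (rev-involutive d)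

  τ-injective : ∀ {d d′} → τ d ≡ τ d′ → d ≡ d′
  τ-injective {d} {d′} eq = trans (sym (τ⁻τ d)) (trans (cong τ⁻ eq) (τ⁻τ d′))

  base-τ : ∀ d → base (τ d) ≡ head d
  base-τ d = ρ-base (rev d)

  joins-dart : ∀ d → Joins (edge d) (base d) (head d)
  joins-dart (e , false) = inj₁ refl
  joins-dart (e , true)  = inj₂ refl

  φ : Dart → Fin F
  φ = proj₁ faces

  φ-τ : ∀ d → φ (τ d) ≡ φ d
  φ-τ d = sym (proj₂ (proj₂ (proj₂ faces) d (τ d)) (1 , refl))

  f₀ : Fin F
  f₀ = φ (proj₁ walk)

  walk-covers : ∀ e → ∃[ b ] φ (e , b) ≡ f₀
  walk-covers e with proj₂ walk e
  ... | b , orbit = b , sym (proj₂ (proj₂ (proj₂ faces) (proj₁ walk) (e , b)) orbit)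

  outside : Dart → ℕ
  outside d = χ (¬? (φ d Fin.≟ f₀))

  cost : Fin A → ℕ
  cost e = 1 + 2 * χ (¬? (canonical? e))

  weight : Dart → ℕ
  weight d = outside d * cost (edge d)

  faceWeight : Fin F → ℕ
  faceWeight f = ∑ᴰ (λ d → χ (f Fin.≟ φ d) * weight d)

  cost-loop : ∀ e → proj₁ (end e) ≡ proj₂ (end e) → cost e ≡ 3
  cost-loop e loop = cong (λ x → 1 + 2 * x) (χ-yes (¬? (canonical? e)) (λ can → canonical-not-loop can loop))

  cost-parallel : ∀ {e e′ u v} → e ≢ e′ → Joins e u v → Joins e′ u v → 4 ≤ cost e + cost e′
  cost-parallel {e} {e′} e≢e′ j j′ = by-cases (canonical? e) (canonical? e′)
    where
    by-cases : (c : Dec (Canonical e)) (c′ : Dec (Canonical e′)) →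
               4 ≤ (1 + 2 * χ (¬? c)) + (1 + 2 * χ (¬? c′))
    by-cases (yes can) (yes can′) = contradiction (canonical-unique can can′ j j′) e≢e′
    by-cases (yes _)   (no _)     = s≤s (s≤s (s≤s (s≤s z≤n)))
    by-cases (no _)    _          = s≤s (s≤s (s≤s (s≤s z≤n)))

  1≤cost : ∀ e → 1 ≤ cost e
  1≤cost e = s≤s z≤n

  loop-dart : ∀ d → base d ≡ head d → proj₁ (end (edge d)) ≡ proj₂ (end (edge d))
  loop-dart (e , false) eq = eq
  loop-dart (e , true)  eq = sym eq

  weight-in-face : ∀ {f d} → f ≢ f₀ → φ d ≡ f → χ (f Fin.≟ φ d) * weight d ≡ cost (edge d)
  weight-in-face {f} {d} f≢f₀ φd≡f = begin
    χ (f Fin.≟ φ d) * (outside d * cost (edge d))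
      ≡⟨ cong₂ (λ x y → x * (y * cost (edge d)))
               (χ-yes (f Fin.≟ φ d) (sym φd≡f)) (χ-yes (¬? (φ d Fin.≟ f₀)) (f≢f₀ ∘ trans (sym φd≡f))) ⟩
    1 * (1 * cost (edge d))
      ≡⟨ trans (*-identityˡ _) (*-identityˡ _) ⟩
    cost (edge d) ∎
    where open ≡-Reasoning

  cost-in-face : ∀ {f} → f ≢ f₀ → ∀ {xs} → Unique xs → All (λ d → φ d ≡ f) xs →
                 ListAction.sum (List.map (cost ∘ edge) xs) ≤ faceWeight f
  cost-in-face {f} f≢f₀ {xs} distinct in-f = begin
    ListAction.sum (List.map (cost ∘ edge) xs)                        ≡⟨ cong ListAction.sum (map-weights in-f) ⟨
    ListAction.sum (List.map (λ d → χ (f Fin.≟ φ d) * weight d) xs)   ≤⟨ ∑ᴰ-distinct _ distinct ⟩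
    faceWeight f                                                  ∎
    where
    open ≤-Reasoning
    map-weights : ∀ {ys} → All (λ d → φ d ≡ f) ys →
                  List.map (λ d → χ (f Fin.≟ φ d) * weight d) ys ≡ List.map (cost ∘ edge) ys
    map-weights []             = refl
    map-weights (φy≡f ∷ in-f′) = cong₂ _∷_ (weight-in-face f≢f₀ φy≡f) (map-weights in-f′)

  φ-surjective : ∀ f → ∃[ d ] φ d ≡ f
  φ-surjective f with proj₁ (proj₂ faces) f
  ... | d , onto = d , onto refl

  two-orientations : ∀ {d d′} → edge d ≡ edge d′ → d ≢ d′ → ∀ b → (edge d , b) ≡ d ⊎ (edge d , b) ≡ d′
  two-orientations {e , b₁} {.e , b₂} refl d≢d′ b =
    Sum.map (cong (e ,_)) (cong (e ,_)) (other b₁ b₂ b (d≢d′ ∘ cong (e ,_)))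
    where
    other : ∀ b₁ b₂ b → b₁ ≢ b₂ → b ≡ b₁ ⊎ b ≡ b₂
    other false false _     b₁≢b₂ = contradiction refl b₁≢b₂
    other true  true  _     b₁≢b₂ = contradiction refl b₁≢b₂
    other false true  false _     = inj₁ refl
    other false true  true  _     = inj₂ refl
    other true  false false _     = inj₂ refl
    other true  false true  _     = inj₁ refl

  module _ {f x} (f≢f₀ : f ≢ f₀) (φx : φ x ≡ f) where

    φτx : φ (τ x) ≡ f
    φτx = trans (φ-τ x) φx

    monogon : τ x ≡ x → 3 ≤ faceWeight f
    monogon τx≡x = begin
      3                  ≡⟨ cost-loop (edge x) (loop-dart x (trans (cong base (sym τx≡x)) (base-τ x))) ⟨
      cost (edge x)      ≡⟨ +-identityʳ _ ⟨
      cost (edge x) + 0  ≤⟨ cost-in-face f≢f₀ ([] ∷ []) (φx ∷ []) ⟩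
      faceWeight f       ∎
      where open ≤-Reasoning

    digon : τ x ≢ x → τ (τ x) ≡ x → 3 ≤ faceWeight f
    digon τx≢x ττx≡x with edge (τ x) Fin.≟ edge x
    ... | yes same-edge = contradiction (trans (sym (both-in-f b)) in-walk) f≢f₀
      where
      b = proj₁ (walk-covers (edge x))
      in-walk = proj₂ (walk-covers (edge x))
      both-in-f : ∀ b → φ (edge x , b) ≡ f
      both-in-f b with two-orientations (sym same-edge) (τx≢x ∘ sym) b
      ... | inj₁ eb≡x  = trans (cong φ eb≡x) φx
      ... | inj₂ eb≡τx = trans (cong φ eb≡τx) φτx
    ... | no other-edge = begin
      3                                        ≤⟨ n≤1+n 3 ⟩
      4                                        ≤⟨ cost-parallel (other-edge ∘ sym) (joins-dart x) τx-joins ⟩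
      cost (edge x) + cost (edge (τ x))        ≡⟨ cong (cost (edge x) +_) (+-identityʳ _) ⟨
      cost (edge x) + (cost (edge (τ x)) + 0)  ≤⟨ cost-in-face f≢f₀ (((τx≢x ∘ sym) ∷ []) ∷ [] ∷ []) (φx ∷ φτx ∷ []) ⟩
      faceWeight f                             ∎
      where
      open ≤-Reasoning
      τx-joins : Joins (edge (τ x)) (base x) (head x)
      τx-joins = joins-sym (subst₂ (Joins (edge (τ x))) (base-τ x)
                                   (trans (sym (base-τ (τ x))) (cong base ττx≡x)) (joins-dart (τ x)))

    polygon : τ x ≢ x → τ (τ x) ≢ x → 3 ≤ faceWeight f
    polygon τx≢x ττx≢x = ≤-trans (+-mono-≤ (1≤cost _) (+-mono-≤ (1≤cost _) (+-mono-≤ (1≤cost _) z≤n)))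
      (cost-in-face f≢f₀ (((τx≢x ∘ sym) ∷ (ττx≢x ∘ sym) ∷ []) ∷ ((τx≢x ∘ τ-injective ∘ sym) ∷ []) ∷ [] ∷ [])
                         (φx ∷ φτx ∷ trans (φ-τ (τ x)) φτx ∷ []))

  faceWeight-≥3 : ∀ f → f ≢ f₀ → 3 ≤ faceWeight f
  faceWeight-≥3 f f≢f₀ with φ-surjective f
  ... | x , φx with τ x ≟ᴰ x | τ (τ x) ≟ᴰ x
  ...   | yes τx≡x | _         = monogon f≢f₀ φx τx≡x
  ...   | no τx≢x  | yes ττx≡x = digon f≢f₀ φx τx≢x ττx≡x
  ...   | no τx≢x  | no ττx≢x  = polygon f≢f₀ φx τx≢x ττx≢x

  ∑faceWeight : ∑[ f < F ] faceWeight f ≡ ∑ᴰ weight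
  ∑faceWeight = begin
    ∑[ f < F ] ∑ᴰ (λ d → χ (f Fin.≟ φ d) * weight d) ≡⟨ ∑ᴰ-comm-∑ (λ d f → χ (f Fin.≟ φ d) * weight d) ⟨
    ∑ᴰ (λ d → ∑[ f < F ] (χ (f Fin.≟ φ d) * weight d)) ≡⟨ ∑ᴰ-cong (λ d → ∑-indicator (φ d) (weight d)) ⟩
    ∑ᴰ weight                                          ∎
    where open ≡-Reasoning

  face-lower-bound : ∀ f → 3 ≤ χ (f Fin.≟ f₀) * 3 + faceWeight f
  face-lower-bound f = by-cases (f Fin.≟ f₀)
    where
    by-cases : (f≟f₀ : Dec (f ≡ f₀)) → 3 ≤ χ f≟f₀ * 3 + faceWeight f
    by-cases (yes _)    = m≤m+n 3 (faceWeight f)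
    by-cases (no f≢f₀) = faceWeight-≥3 f f≢f₀

  ∑face-lower-bound : ∑[ f < F ] (χ (f Fin.≟ f₀) * 3 + faceWeight f) ≡ ∑ᴰ weight + 3
  ∑face-lower-bound = begin
    ∑[ f < F ] (χ (f Fin.≟ f₀) * 3 + faceWeight f)           ≡⟨ ∑-distrib-+ (λ f → χ (f Fin.≟ f₀) * 3) faceWeight ⟩
    ∑[ f < F ] (χ (f Fin.≟ f₀) * 3) + ∑[ f < F ] faceWeight f ≡⟨ cong₂ _+_ (∑-indicator f₀ 3) ∑faceWeight ⟩
    3 + ∑ᴰ weight                                              ≡⟨ +-comm 3 _ ⟩
    ∑ᴰ weight + 3                                              ∎
    where open ≡-Reasoning

  ∑3≡3F : ∑[ f < F ] 3 ≡ 3 * F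
  ∑3≡3F = trans (∑-const F 3) (*-comm F 3)

  faces-≤-weight : 3 * F ≤ ∑ᴰ weight + 3
  faces-≤-weight = begin
    3 * F                                            ≡⟨ ∑3≡3F ⟨
    ∑[ f < F ] 3                                     ≤⟨ ∑-mono-≤ face-lower-bound ⟩
    ∑[ f < F ] (χ (f Fin.≟ f₀) * 3 + faceWeight f)  ≡⟨ ∑face-lower-bound ⟩
    ∑ᴰ weight + 3                                    ∎
    where open ≤-Reasoning

  outside-walk : ∀ {d} → φ d ≡ f₀ → outside d ≡ 0
  outside-walk {d} in-walk = χ-no (¬? (φ d Fin.≟ f₀)) (λ out → out in-walk)

  outside-edge : ∀ e → outside (e , false) + outside (e , true) ≤ 1
  outside-edge e with walk-covers e
  ... | false , in-walk = +-mono-≤ (≤-reflexive (outside-walk in-walk)) (χ≤1 (¬? (φ (e , true) Fin.≟ f₀)))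
  ... | true  , in-walk = +-mono-≤ (χ≤1 (¬? (φ (e , false) Fin.≟ f₀))) (≤-reflexive (outside-walk in-walk))

  weight-edge : ∀ e → weight (e , false) + weight (e , true) ≤ cost e
  weight-edge e = begin
    outside (e , false) * cost e + outside (e , true) * cost e ≡⟨ *-distribʳ-+ (cost e) (outside (e , false)) _ ⟨
    (outside (e , false) + outside (e , true)) * cost e       ≤⟨ *-monoˡ-≤ (cost e) (outside-edge e) ⟩
    1 * cost e                                               ≡⟨ *-identityˡ (cost e) ⟩
    cost e                                                   ∎
    where open ≤-Reasoning

  ∑cost : ∑[ e < A ] cost e + 2 * Ar ≡ 3 * A
  ∑cost = begin
    ∑[ e < A ] cost e + 2 * Ar
      ≡⟨ cong (λ n → ∑[ e < A ] cost e + 2 * n) (Ar≡#canonical) ⟩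
    ∑[ e < A ] cost e + 2 * ∑[ e < A ] χ (canonical? e)
      ≡⟨ cong (∑[ e < A ] cost e +_) (*-distribˡ-sum 2 (λ e → χ (canonical? e))) ⟩
    ∑[ e < A ] cost e + ∑[ e < A ] (2 * χ (canonical? e))
      ≡⟨ ∑-distrib-+ cost (λ e → 2 * χ (canonical? e)) ⟨
    ∑[ e < A ] (cost e + 2 * χ (canonical? e))
      ≡⟨ sum-cong-≗ (λ e → cost+2χ (canonical? e)) ⟩
    ∑[ e < A ] 3
      ≡⟨ trans (∑-const A 3) (*-comm A 3) ⟩
    3 * A ∎
    where
    open ≡-Reasoning
    cost+2χ : ∀ {P : Set} (p? : Dec P) → 1 + 2 * χ (¬? p?) + 2 * χ p? ≡ 3
    cost+2χ (yes _) = refl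
    cost+2χ (no _)  = refl

  faces-≤-cost : 3 * F ≤ ∑[ e < A ] cost e + 3
  faces-≤-cost = ≤-trans faces-≤-weight (+-monoˡ-≤ 3 (∑-mono-≤ weight-edge))

  euler₃ : 3 * F + (3 * S + 6 * g) ≡ 3 * A + 6
  euler₃ = begin
    3 * F + (3 * S + 6 * g)
      ≡⟨ solve 3 (λ s f g → con 3 :* f :+ (con 3 :* s :+ con 6 :* g) := con 3 :* (s :+ f :+ con 2 :* g)) refl S F g ⟩
    3 * (S + F + 2 * g)     ≡⟨ cong (3 *_) euler ⟩
    3 * (A + 2)             ≡⟨ *-distribˡ-+ 3 A 2 ⟩
    3 * A + 6               ∎
    where
    open ≡-Reasoning
    open +-*-Solver

  reduced-edge-bound : 2 * Ar + 3 ≤ 3 * S + 6 * g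
  reduced-edge-bound = +-cancelˡ-≤ (3 * F) _ _ (begin
    3 * F + (2 * Ar + 3)                         ≤⟨ +-monoˡ-≤ (2 * Ar + 3) faces-≤-cost ⟩
    ∑[ e < A ] cost e + 3 + (2 * Ar + 3)
      ≡⟨ solve 2 (λ c a → c :+ con 3 :+ (a :+ con 3) := c :+ a :+ con 6) refl (∑[ e < A ] cost e) (2 * Ar) ⟩
    ∑[ e < A ] cost e + 2 * Ar + 6               ≡⟨ cong (_+ 6) ∑cost ⟩
    3 * A + 6                                    ≡⟨ euler₃ ⟨
    3 * F + (3 * S + 6 * g)                      ∎)
    where
    open ≤-Reasoning
    open +-*-Solver

  module Tight (tight : 2 * Ar + 3 ≡ 3 * S + 6 * g) where

    faces≡cost : 3 * F ≡ ∑[ e < A ] cost e + 3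
    faces≡cost = +-cancelʳ-≡ (3 * S + 6 * g) _ _ (begin
      3 * F + (3 * S + 6 * g)                        ≡⟨ euler₃ ⟩
      3 * A + 6                                      ≡⟨ cong (_+ 6) ∑cost ⟨
      ∑[ e < A ] cost e + 2 * Ar + 6
        ≡⟨ solve 2 (λ c a → c :+ a :+ con 6 := c :+ con 3 :+ (a :+ con 3)) refl (∑[ e < A ] cost e) (2 * Ar) ⟩
      ∑[ e < A ] cost e + 3 + (2 * Ar + 3)           ≡⟨ cong (∑[ e < A ] cost e + 3 +_) tight ⟩
      ∑[ e < A ] cost e + 3 + (3 * S + 6 * g)        ∎)
      where
      open ≡-Reasoning
      open +-*-Solver

    weight≡cost : ∑ᴰ weight ≡ ∑[ e < A ] cost e
    weight≡cost = ≤-antisym (∑-mono-≤ weight-edge)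
      (+-cancelʳ-≤ 3 _ _ (≤-trans (≤-reflexive (sym faces≡cost)) faces-≤-weight))

    faceWeight≡3 : ∀ f → f ≢ f₀ → faceWeight f ≡ 3
    faceWeight≡3 f f≢f₀ = sym (trans (∑-rigid face-lower-bound (≤-reflexive ∑≡∑3) f)
                                      (cong (λ x → x * 3 + faceWeight f) (χ-no (f Fin.≟ f₀) f≢f₀)))
      where
      ∑≡∑3 : ∑[ f < F ] (χ (f Fin.≟ f₀) * 3 + faceWeight f) ≡ ∑[ f < F ] 3
      ∑≡∑3 = trans ∑face-lower-bound (trans (cong (_+ 3) weight≡cost) (trans (sym faces≡cost) (sym ∑3≡3F)))

    one-outside : ∀ e → outside (e , false) + outside (e , true) ≡ 1
    one-outside e = *-cancelʳ-≡ _ 1 (cost e) (begin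
      (outside (e , false) + outside (e , true)) * cost e  ≡⟨ *-distribʳ-+ (cost e) (outside (e , false)) _ ⟩
      weight (e , false) + weight (e , true)               ≡⟨ ∑-rigid weight-edge (≤-reflexive (sym weight≡cost)) e ⟩
      cost e                                               ≡⟨ *-identityˡ (cost e) ⟨
      1 * cost e                                           ∎)
      where open ≡-Reasoning

    outside-dart : ∀ e → ∃[ b ] φ (e , b) ≢ f₀
    outside-dart e with φ (e , false) Fin.≟ f₀
    ... | no out      = false , out
    ... | yes in-walk = true , χ≡1⇒ (¬? (φ (e , true) Fin.≟ f₀)) (begin
      outside (e , true)                          ≡⟨ cong (_+ outside (e , true)) (outside-walk in-walk) ⟨
      outside (e , false) + outside (e , true)    ≡⟨ one-outside e ⟩
      1                                           ∎)
      where open ≡-Reasoning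

    non-loop⇒canonical : ∀ e → proj₁ (end e) ≢ proj₂ (end e) → Canonical e
    non-loop⇒canonical e non-loop with canonical? e
    ... | yes can = can
    ... | no ¬can with outside-dart e
    ...   | b , out with τ (e , b) ≟ᴰ (e , b)
    ...     | yes τd≡d = contradiction (loop-dart (e , b) (trans (cong base (sym τd≡d)) (base-τ (e , b)))) non-loop
    ...     | no τd≢d  = contradiction (begin
      4                                          ≡⟨ cong (_+ 1) cost≡3 ⟨
      cost e + 1                                 ≤⟨ +-monoʳ-≤ (cost e) (+-monoˡ-≤ 0 (1≤cost (edge (τ (e , b))))) ⟩
      cost e + (cost (edge (τ (e , b))) + 0)     ≤⟨ cost-in-face out (((τd≢d ∘ sym) ∷ []) ∷ [] ∷ []) (refl ∷ φ-τ (e , b) ∷ []) ⟩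
      faceWeight (φ (e , b))                     ≡⟨ faceWeight≡3 (φ (e , b)) out ⟩
      3                                          ∎) (<-irrefl refl)
      where
      open ≤-Reasoning
      cost≡3 : cost e ≡ 3
      cost≡3 = cong (λ x → 1 + 2 * x) (χ-yes (¬? (canonical? e)) ¬can)

    module _ (p : Fin S) where

      ι : Fin S → ℕ
      ι v = χ (p Fin.≟ v)

      heads≡bases : ∑ᴰ (λ d → outside d * ι (head d)) ≡ ∑ᴰ (λ d → outside d * ι (base d))
      heads≡bases = trans
        (∑ᴰ-cong λ d → cong₂ (λ x v → x * ι v) (cong (λ f → χ (¬? (f Fin.≟ f₀))) (sym (φ-τ d)))
                                                (sym (base-τ d)))
        (∑ᴰ-permute τ τ⁻ ττ⁻ τ⁻τ (λ d → outside d * ι (base d)))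

      outside-ends-even : 2 ∣ ∑ᴰ (λ d → outside d * (ι (base d) + ι (head d)))
      outside-ends-even = divides (∑ᴰ (λ d → outside d * ι (base d))) (begin
        ∑ᴰ (λ d → outside d * (ι (base d) + ι (head d)))
          ≡⟨ ∑ᴰ-cong (λ d → *-distribˡ-+ (outside d) (ι (base d)) (ι (head d))) ⟩
        ∑ᴰ (λ d → outside d * ι (base d) + outside d * ι (head d))
          ≡⟨ ∑ᴰ-distrib-+ (λ d → outside d * ι (base d)) (λ d → outside d * ι (head d)) ⟩
        ∑ᴰ (λ d → outside d * ι (base d)) + ∑ᴰ (λ d → outside d * ι (head d))
          ≡⟨ cong (∑ᴰ (λ d → outside d * ι (base d)) +_) heads≡bases ⟩
        ∑ᴰ (λ d → outside d * ι (base d)) + ∑ᴰ (λ d → outside d * ι (base d))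
          ≡⟨ solve 1 (λ x → x :+ x := x :* con 2) refl (∑ᴰ (λ d → outside d * ι (base d))) ⟩
        ∑ᴰ (λ d → outside d * ι (base d)) * 2 ∎)
        where
        open ≡-Reasoning
        open +-*-Solver

      outside-ends : ∑ᴰ (λ d → outside d * (ι (base d) + ι (head d))) ≡ ∑[ e < A ] ends-at p e
      outside-ends = sum-cong-≗ at-edge
        where
        open ≡-Reasoning
        at-edge : ∀ e → outside (e , false) * (ι (proj₁ (end e)) + ι (proj₂ (end e)))
                        + outside (e , true) * (ι (proj₂ (end e)) + ι (proj₁ (end e))) ≡ ends-at p e
        at-edge e = begin
          outside (e , false) * (ι x + ι y) + outside (e , true) * (ι y + ι x)
            ≡⟨ cong (λ n → outside (e , false) * (ι x + ι y) + outside (e , true) * n) (+-comm (ι y) (ι x)) ⟩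
          outside (e , false) * ends-at p e + outside (e , true) * ends-at p e
            ≡⟨ *-distribʳ-+ (ends-at p e) (outside (e , false)) (outside (e , true)) ⟨
          (outside (e , false) + outside (e , true)) * ends-at p e
            ≡⟨ cong (_* ends-at p e) (one-outside e) ⟩
          1 * ends-at p e
            ≡⟨ *-identityˡ _ ⟩
          ends-at p e ∎
          where
          x = proj₁ (end e)
          y = proj₂ (end e)

      ends-split : ∑[ e < A ] ends-at p e ≡ ∑[ e < A ] (χ (¬? (canonical? e)) * ends-at p e) + reducedDegree p
      ends-split = begin
        ∑[ e < A ] ends-at p e
          ≡⟨ sum-cong-≗ (λ e → χ-split (canonical? e) (ends-at p e)) ⟩
        ∑[ e < A ] (χ (¬? (canonical? e)) * ends-at p e + χ (canonical? e) * ends-at p e)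
          ≡⟨ ∑-distrib-+ (λ e → χ (¬? (canonical? e)) * ends-at p e) (λ e → χ (canonical? e) * ends-at p e) ⟩
        ∑[ e < A ] (χ (¬? (canonical? e)) * ends-at p e) + ∑[ e < A ] (χ (canonical? e) * ends-at p e)
          ≡⟨ cong (∑[ e < A ] (χ (¬? (canonical? e)) * ends-at p e) +_) (reducedDegree≡∑canonical p) ⟨
        ∑[ e < A ] (χ (¬? (canonical? e)) * ends-at p e) + reducedDegree p ∎
        where open ≡-Reasoning

      non-canonical-ends-even : 2 ∣ ∑[ e < A ] (χ (¬? (canonical? e)) * ends-at p e)
      non-canonical-ends-even = divides (∑[ e < A ] (χ (¬? (canonical? e)) * ι (proj₁ (end e)))) (begin
        ∑[ e < A ] (χ (¬? (canonical? e)) * ends-at p e)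
          ≡⟨ sum-cong-≗ (λ e → at-loop e (canonical? e)) ⟩
        ∑[ e < A ] (2 * (χ (¬? (canonical? e)) * ι (proj₁ (end e))))
          ≡⟨ *-distribˡ-sum 2 (λ e → χ (¬? (canonical? e)) * ι (proj₁ (end e))) ⟨
        2 * ∑[ e < A ] (χ (¬? (canonical? e)) * ι (proj₁ (end e)))
          ≡⟨ *-comm 2 (∑[ e < A ] (χ (¬? (canonical? e)) * ι (proj₁ (end e)))) ⟩
        ∑[ e < A ] (χ (¬? (canonical? e)) * ι (proj₁ (end e))) * 2 ∎)
        where
        open ≡-Reasoning
        at-loop : ∀ e (can? : Dec (Canonical e)) →
                  χ (¬? can?) * ends-at p e ≡ 2 * (χ (¬? can?) * ι (proj₁ (end e)))
        at-loop e (yes _)   = refl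
        at-loop e (no ¬can) with proj₁ (end e) Fin.≟ proj₂ (end e)
        ... | no non-loop = contradiction (non-loop⇒canonical e non-loop) ¬can
        ... | yes loop    = trans (cong (λ v → 1 * (ι (proj₁ (end e)) + ι v)) (sym loop))
                                     (solve 1 (λ x → con 1 :* (x :+ x) := con 2 :* (con 1 :* x)) refl (ι (proj₁ (end e))))
          where open +-*-Solver

      reducedDegree-even : 2 ∣ reducedDegree p
      reducedDegree-even =
        ∣m+n∣m⇒∣n (subst (2 ∣_) (trans outside-ends ends-split) outside-ends-even) non-canonical-ends-even

-- Bounding the reduced valence

Feasible : ℕ → ℕ → ℕ → Set
Feasible g S a = 2 * a + S ≤ S * S × 2 * a + 3 ≤ 3 * S + 6 * g

feasible? : ∀ g S a → Dec (Feasible g S a)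
feasible? g S a = 2 * a + S ≤? S * S ×-dec 2 * a + 3 ≤? 3 * S + 6 * g

-- V_r ≤ 3 + c/q, under an extra decidable hypothesis E on (S, a).  For S ≥ K
-- this follows from 2a + 3 ≤ 3S + 3 + m as soon as mq ≤ cK; the finitely many
-- feasible pairs with S < K are checked one by one.
module ValenceBound (g q c K : ℕ) {E : ℕ → ℕ → Set} (E? : ∀ S a → Dec (E S a)) where

  Bounded : ℕ → ℕ → Set
  Bounded S a = 2 * a * q ≤ (3 * q + c) * S

  small-cases? : Dec (∀ {S} → S < K → ∀ {a} → a < suc (S * S) → Feasible g S a → E S a → Bounded S a)
  small-cases? = allUpTo? (λ S → allUpTo? (λ a → feasible? g S a →-dec E? S a →-dec 2 * a * q ≤? (3 * q + c) * S)
                                          (suc (S * S)))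
                          K

  large-case : ∀ {m S a} → 3 + m ≡ 6 * g → m * q ≤ c * K → K ≤ S → Feasible g S a → Bounded S a
  large-case {m} {S} {a} 3+m≡6g mq≤cK K≤S (_ , edges) = begin
    2 * a * q             ≤⟨ *-monoˡ-≤ q 2a≤3S+m ⟩
    (3 * S + m) * q       ≡⟨ *-distribʳ-+ q (3 * S) m ⟩
    3 * S * q + m * q     ≤⟨ +-monoʳ-≤ (3 * S * q) (≤-trans mq≤cK (*-monoʳ-≤ c K≤S)) ⟩
    3 * S * q + c * S     ≡⟨ solve 3 (λ S q c → con 3 :* S :* q :+ c :* S := (con 3 :* q :+ c) :* S) refl S q c ⟩
    (3 * q + c) * S       ∎
    where
    open ≤-Reasoning
    open +-*-Solver
    2a≤3S+m : 2 * a ≤ 3 * S + m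
    2a≤3S+m = +-cancelʳ-≤ 3 _ _ (subst (2 * a + 3 ≤_) 3S+6g≡3S+m+3 edges)
      where
      3S+6g≡3S+m+3 : 3 * S + 6 * g ≡ 3 * S + m + 3
      3S+6g≡3S+m+3 = trans (cong (3 * S +_) (sym 3+m≡6g)) (solve 2 (λ s m → s :+ (con 3 :+ m) := s :+ m :+ con 3) refl (3 * S) m)

  valence-bound : ∀ m → 3 + m ≡ 6 * g → {True (m * q ≤? c * K)} → {True small-cases?} →
                  ∀ S a → Feasible g S a → E S a → Bounded S a
  valence-bound m 3+m≡6g {mq≤cK} {small} S a feasible e with S ℕ.<? K
  ... | yes S<K = toWitness small S<K {a} (s≤s a≤S*S) feasible e
    where
    a≤S*S : a ≤ S * S
    a≤S*S = ≤-trans (m≤m+n a (a + 0)) (≤-trans (m≤m+n (2 * a) S) (proj₁ feasible))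
  ... | no S≮K  = large-case {S = S} {a = a} 3+m≡6g (toWitness mq≤cK) (≮⇒≥ S≮K) feasible

open import Data.Integer.Base as ℤ using (+_)
open import Data.Integer.Properties using (+◃n≡+n)

/-mono-≤ : ∀ a b c d → a * suc d ≤ c * suc b → (+ a) / suc b ℚ.≤ (+ c) / suc d
/-mono-≤ a b c d ad≤cb = toℚᵘ-cancel-≤ (≤-respˡ-≃ (≃-sym (toℚᵘ-fromℚᵘ (mkℚᵘ (+ a) b)))
  (≤-respʳ-≃ (≃-sym (toℚᵘ-fromℚᵘ (mkℚᵘ (+ c) d)))
    (*≤* (subst₂ ℤ._≤_ (sym (+◃n≡+n _)) (sym (+◃n≡+n _)) (ℤ.+≤+ ad≤cb)))))

Vr-≤ : ∀ (G : Graph) p q → 2 * Graph.Ar G * suc q ≤ p * Graph.S G → Graph.Vr G ℚ.≤ (+ p) / suc q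
Vr-≤ record { S = zero  } p q _     = /-mono-≤ 0 0 p q z≤n
Vr-≤ G@record { S = suc n } p q bound = /-mono-≤ (2 * Graph.Ar G) n p q bound

-- Certified embeddings

iter-shift : ∀ {X : Set} (f : X → X) k x → iter f k (f x) ≡ f (iter f k x)
iter-shift f zero    x = refl
iter-shift f (suc k) x = cong f (iter-shift f k x)

orbit-invariant : ∀ {X Y : Set} (f : X → X) (h : X → Y) → (∀ x → h (f x) ≡ h x) →
                  ∀ {x y} → SameOrbit f x y → h x ≡ h y
orbit-invariant f h inv {x} (zero , refl) = refl
orbit-invariant f h inv {x} (suc k , refl) = trans (orbit-invariant f h inv (k , refl)) (sym (inv (iter f k x)))

module Certificate (g S A F : ℕ) (end : Fin A → Fin S × Fin S)
                   (ρ : Fin A × Bool → Fin A × Bool) (φ : Fin A × Bool → Fin F) where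

  graph : Graph
  graph = record { S = S ; A = A ; end = end }

  open Graph graph hiding (S; A; end)
  open DartSum A using (_≟ᴰ_)

  all-darts? : ∀ {P : Dart → Set} → (∀ d → Dec (P d)) → Dec (∀ d → P d)
  all-darts? P? = map′ (λ { ∀P (e , false) → proj₁ (∀P e) ; ∀P (e , true) → proj₂ (∀P e) })
                       (λ ∀P e → ∀P (e , false) , ∀P (e , true))
                       (all? λ e → P? (e , false) ×-dec P? (e , true))

  any-dart? : ∀ {P : Dart → Set} → (∀ d → Dec (P d)) → Dec (∃[ d ] P d)
  any-dart? P? = map′ (λ { (e , inj₁ p) → (e , false) , p ; (e , inj₂ p) → (e , true) , p })
                      (λ { ((e , false) , p) → e , inj₁ p ; ((e , true) , p) → e , inj₂ p })
                      (any? λ e → P? (e , false) ⊎-dec P? (e , true))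

  -- d itself when d has no preimage; `Valid` rules this out.
  ρ⁻ : Dart → Dart
  ρ⁻ d with any-dart? (λ d′ → ρ d′ ≟ᴰ d)
  ... | yes (d′ , _) = d′
  ... | no _         = d

  τ : Dart → Dart
  τ d = ρ (rev d)

  search : (f : Dart → Dart) → ℕ → ∀ x y → Maybe (SameOrbit f x y)
  search f zero    x y = nothing
  search f (suc n) x y with x ≟ᴰ y
  ... | yes x≡y = just (0 , x≡y)
  ... | no _    = Maybe.map (λ { (k , p) → suc k , trans (sym (iter-shift f k x)) p }) (search f n (f x) y)

  Orbit : (Dart → Dart) → Dart → Dart → Set
  Orbit f x y = Is-just (search f (2 * A) x y)

  orbit? : ∀ f x y → Dec (Orbit f x y)
  orbit? f x y = Is-just.dec (λ _ → yes tt) (search f (2 * A) x y)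

  Near : Fin S → Fin S → Set
  Near u v = u ≡ v ⊎ Adj u v ⊎ ∃[ w ] Adj u w × Adj w v

  near? : ∀ u v → Dec (Near u v)
  near? u v = u Fin.≟ v ⊎-dec adj? u v ⊎-dec any? (λ w → adj? u w ×-dec adj? w v)

  _≟ₑ_ : (p q : Fin S × Fin S) → Dec (p ≡ q)
  _≟ₑ_ = ≡-dec Fin._≟_ Fin._≟_

  CompleteWalkFrom : Dart → Set
  CompleteWalkFrom d₀ = ∀ e → Orbit τ d₀ (e , false) ⊎ Orbit τ d₀ (e , true)

  record Valid : Set where
    field
      nonempty  : 0 < S
      near      : ∀ u v → Near u v
      ρρ⁻       : ∀ d → ρ (ρ⁻ d) ≡ d
      ρ⁻ρ       : ∀ d → ρ⁻ (ρ d) ≡ d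
      ρ-base    : ∀ d → base (ρ d) ≡ base d
      ρ-orbits  : ∀ d d′ → base d ≡ base d′ → Orbit ρ d d′
      φ-τ       : ∀ d → φ (τ d) ≡ φ d
      φ-orbits  : ∀ d d′ → φ d ≡ φ d′ → Orbit τ d d′
      φ-onto    : ∀ f → ∃[ d ] φ d ≡ f
      walk      : ∃[ d₀ ] CompleteWalkFrom d₀
      loopless  : ∀ e → proj₁ (end e) ≢ proj₂ (end e)
      simple    : ∀ e e′ → e ≢ e′ → end e ≢ end e′ × end e ≢ (proj₂ (end e′) , proj₁ (end e′))
      euler     : S + F + 2 * g ≡ A + 2

  valid? : Dec Valid
  valid? = map′
    (λ (a , b , c , d , e , f , g′ , h , i , j , k , l , m) → record
      { nonempty = a ; near = b ; ρρ⁻ = c ; ρ⁻ρ = d ; ρ-base = e ; ρ-orbits = f ; φ-τ = g′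
      ; φ-orbits = h ; φ-onto = i ; walk = j ; loopless = k ; simple = l ; euler = m })
    (λ v → let open Valid v in
      nonempty , near , ρρ⁻ , ρ⁻ρ , ρ-base , ρ-orbits , φ-τ , φ-orbits , φ-onto , walk , loopless , simple , euler)
    (0 ℕ.<? S
      ×-dec all? (λ u → all? (near? u))
      ×-dec all-darts? (λ d → ρ (ρ⁻ d) ≟ᴰ d)
      ×-dec all-darts? (λ d → ρ⁻ (ρ d) ≟ᴰ d)
      ×-dec all-darts? (λ d → base (ρ d) Fin.≟ base d)
      ×-dec all-darts? (λ d → all-darts? (λ d′ → base d Fin.≟ base d′ →-dec orbit? ρ d d′))
      ×-dec all-darts? (λ d → φ (τ d) Fin.≟ φ d)
      ×-dec all-darts? (λ d → all-darts? (λ d′ → φ d Fin.≟ φ d′ →-dec orbit? τ d d′))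
      ×-dec all? (λ f → any-dart? (λ d → φ d Fin.≟ f))
      ×-dec any-dart? (λ d₀ → all? (λ e → orbit? τ d₀ (e , false) ⊎-dec orbit? τ d₀ (e , true)))
      ×-dec all? (λ e → ¬? (proj₁ (end e) Fin.≟ proj₂ (end e)))
      ×-dec all? (λ e → all? (λ e′ → ¬? (e Fin.≟ e′)
                                →-dec ¬? (end e ≟ₑ end e′) ×-dec ¬? (end e ≟ₑ (proj₂ (end e′) , proj₁ (end e′)))))
      ×-dec S + F + 2 * g ℕ.≟ A + 2)

  module _ (valid : Valid) where
    open Valid valid

    reach : ∀ u v → Reach u v
    reach u v with near u v
    ... | inj₁ refl                = here
    ... | inj₂ (inj₁ uv)           = step uv here
    ... | inj₂ (inj₂ (w , uw , wv)) = step uw (step wv here)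

    polarized : Polarized
    polarized = record
      { graph = graph ; connected = nonempty , reach ; ρ = ρ ; ρ⁻ = ρ⁻ ; ρρ⁻ = ρρ⁻ ; ρ⁻ρ = ρ⁻ρ ; ρ-base = ρ-base
      ; ρ-cyclic = λ d d′ eq → to-witness (ρ-orbits d d′ eq) }

    embedding : CellEmb g
    embedding = record
      { pol = polarized ; F = F ; euler = euler
      ; faces = φ , (λ f → proj₁ (φ-onto f) , λ { refl → proj₂ (φ-onto f) })
                  , λ x y → (λ eq → to-witness (φ-orbits x y eq)) , orbit-invariant τ φ φ-τ }

    complete : CellEmb.HasCompleteLeftWalk embedding
    complete = proj₁ walk , λ e → from-orbit (proj₂ walk e)
      where
      from-orbit : ∀ {e} → Orbit τ (proj₁ walk) (e , false) ⊎ Orbit τ (proj₁ walk) (e , true) →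
                   ∃[ b ] SameOrbit τ (proj₁ walk) (e , b)
      from-orbit (inj₁ o) = false , to-witness o
      from-orbit (inj₂ o) = true , to-witness o

    ordinary : Ordinary
    ordinary = loopless , simple

Attained : ℕ → ℚ → Set₁
Attained g x = Σ (CellEmb g) λ G → CellEmb.Ordinary G × CellEmb.HasCompleteLeftWalk G × CellEmb.Vr G ≡ x

byDart : ∀ {X : Set} {A} → Vec X A × Vec X A → Fin A × Bool → X
byDart (forward , backward) (e , false) = lookup forward e
byDart (forward , backward) (e , true)  = lookup backward e

module Tables (S A F : ℕ) {{_ : NonZero S}} {{_ : NonZero A}} {{_ : NonZero F}}
              (ends : Vec (ℕ × ℕ) A) (rotation : Vec (ℕ × Bool) A × Vec (ℕ × Bool) A)
              (faces : Vec ℕ A × Vec ℕ A) where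

  end : Fin A → Fin S × Fin S
  end e = proj₁ (lookup ends e) mod S , proj₂ (lookup ends e) mod S

  ρ : Fin A × Bool → Fin A × Bool
  ρ d = proj₁ (byDart rotation d) mod A , proj₂ (byDart rotation d)

  φ : Fin A × Bool → Fin F
  φ d = byDart faces d mod F

-- An embedding is given by its edges, the rotation of the darts (e , false) and
-- (e , true), and the face on the left of each of these darts.  Entries are read
-- modulo the table size; all of them are in range.
attain : ∀ g S A F {{_ : NonZero S}} {{_ : NonZero A}} {{_ : NonZero F}} ends rotation faces {x} →
         let open Tables S A F ends rotation faces in
         let open Certificate g S A F end ρ φ in
         Graph.Vr graph ≡ x → {ok : True valid?} → Attained g x
attain g S A F ends rotation faces vr {ok} = embedding valid , ordinary valid , complete valid , vr
  where
  open Tables S A F ends rotation faces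
  open Certificate g S A F end ρ φ
  valid = toWitness ok

genus-1 : Attained 1 ((+ 24) / 7)
genus-1 = attain 1 7 12 5 ends (forward , backward) (left , right) refl
  where
  ends : Vec (ℕ × ℕ) 12
  ends = (0 , 1) ∷ (0 , 2) ∷ (0 , 3) ∷ (0 , 4) ∷ (0 , 5) ∷ (0 , 6) ∷ (1 , 2) ∷ (1 , 3) ∷ (1 , 5) ∷
         (3 , 4) ∷ (3 , 5) ∷ (5 , 6) ∷ []
  forward backward : Vec (ℕ × Bool) 12
  forward  = (1 , false) ∷ (3 , false) ∷ (4 , false) ∷ (2 , false) ∷ (5 , false) ∷ (0 , false) ∷
             (0 , true) ∷ (8 , false) ∷ (6 , false) ∷ (10 , false) ∷ (7 , true) ∷ (4 , true) ∷ []
  backward = (7 , false) ∷ (6 , true) ∷ (9 , false) ∷ (9 , true) ∷ (8 , true) ∷ (11 , true) ∷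
             (1 , true) ∷ (2 , true) ∷ (10 , true) ∷ (3 , true) ∷ (11 , false) ∷ (5 , true) ∷ []
  left right : Vec ℕ 12
  left  = 0 ∷ 1 ∷ 2 ∷ 0 ∷ 0 ∷ 3 ∷ 0 ∷ 0 ∷ 4 ∷ 2 ∷ 0 ∷ 0 ∷ []
  right = 1 ∷ 0 ∷ 0 ∷ 2 ∷ 3 ∷ 0 ∷ 1 ∷ 4 ∷ 0 ∷ 0 ∷ 4 ∷ 3 ∷ []

genus-2 : Attained 2 ((+ 13) / 3)
genus-2 = attain 2 6 13 5 ends (forward , backward) (left , right) refl
  where
  ends : Vec (ℕ × ℕ) 13
  ends = (0 , 1) ∷ (0 , 2) ∷ (0 , 3) ∷ (0 , 4) ∷ (0 , 5) ∷ (1 , 2) ∷ (1 , 3) ∷ (1 , 5) ∷ (2 , 4) ∷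
         (2 , 5) ∷ (3 , 4) ∷ (3 , 5) ∷ (4 , 5) ∷ []
  forward backward : Vec (ℕ × Bool) 13
  forward  = (1 , false) ∷ (4 , false) ∷ (3 , false) ∷ (0 , false) ∷ (2 , false) ∷ (0 , true) ∷
             (5 , false) ∷ (6 , false) ∷ (9 , false) ∷ (1 , true) ∷ (2 , true) ∷ (10 , false) ∷
             (8 , true) ∷ []
  backward = (7 , false) ∷ (5 , true) ∷ (6 , true) ∷ (10 , true) ∷ (11 , true) ∷ (8 , false) ∷
             (11 , false) ∷ (9 , true) ∷ (3 , true) ∷ (12 , true) ∷ (12 , false) ∷ (7 , true) ∷
             (4 , true) ∷ []
  left right : Vec ℕ 13
  left  = 0 ∷ 1 ∷ 0 ∷ 2 ∷ 0 ∷ 0 ∷ 3 ∷ 0 ∷ 0 ∷ 4 ∷ 0 ∷ 3 ∷ 0 ∷ []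
  right = 1 ∷ 0 ∷ 2 ∷ 0 ∷ 0 ∷ 1 ∷ 0 ∷ 3 ∷ 4 ∷ 0 ∷ 2 ∷ 0 ∷ 4 ∷ []

genus-3 : Attained 3 ((+ 36) / 7)
genus-3 = attain 3 7 18 7 ends (forward , backward) (left , right) refl
  where
  ends : Vec (ℕ × ℕ) 18
  ends = (0 , 2) ∷ (0 , 4) ∷ (0 , 5) ∷ (0 , 6) ∷ (1 , 2) ∷ (1 , 4) ∷ (1 , 5) ∷ (1 , 6) ∷ (2 , 3) ∷
         (2 , 4) ∷ (2 , 5) ∷ (2 , 6) ∷ (3 , 4) ∷ (3 , 5) ∷ (3 , 6) ∷ (4 , 5) ∷ (4 , 6) ∷ (5 , 6) ∷
         []
  forward backward : Vec (ℕ × Bool) 18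
  forward  = (3 , false) ∷ (2 , false) ∷ (0 , false) ∷ (1 , false) ∷ (5 , false) ∷ (6 , false) ∷
             (7 , false) ∷ (4 , false) ∷ (10 , false) ∷ (4 , true) ∷ (9 , false) ∷ (0 , true) ∷
             (13 , false) ∷ (8 , true) ∷ (12 , false) ∷ (1 , true) ∷ (15 , false) ∷ (6 , true) ∷ []
  backward = (8 , false) ∷ (5 , true) ∷ (15 , true) ∷ (11 , true) ∷ (11 , false) ∷ (9 , true) ∷
             (10 , true) ∷ (17 , true) ∷ (14 , false) ∷ (12 , true) ∷ (13 , true) ∷ (16 , true) ∷
             (16 , false) ∷ (2 , true) ∷ (7 , true) ∷ (17 , false) ∷ (14 , true) ∷ (3 , true) ∷ []
  left right : Vec ℕ 18
  left  = 0 ∷ 0 ∷ 2 ∷ 1 ∷ 0 ∷ 3 ∷ 0 ∷ 4 ∷ 0 ∷ 0 ∷ 5 ∷ 0 ∷ 6 ∷ 0 ∷ 0 ∷ 0 ∷ 6 ∷ 0 ∷ []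
  right = 1 ∷ 2 ∷ 0 ∷ 0 ∷ 3 ∷ 0 ∷ 4 ∷ 0 ∷ 5 ∷ 3 ∷ 0 ∷ 1 ∷ 0 ∷ 5 ∷ 6 ∷ 2 ∷ 0 ∷ 4 ∷ []

genus-4 : Attained 4 ((+ 6) / 1)
genus-4 = attain 4 7 21 8 ends (forward , backward) (left , right) refl
  where
  ends : Vec (ℕ × ℕ) 21
  ends = (0 , 1) ∷ (0 , 2) ∷ (0 , 3) ∷ (0 , 4) ∷ (0 , 5) ∷ (0 , 6) ∷ (1 , 2) ∷ (1 , 3) ∷ (1 , 4) ∷
         (1 , 5) ∷ (1 , 6) ∷ (2 , 3) ∷ (2 , 4) ∷ (2 , 5) ∷ (2 , 6) ∷ (3 , 4) ∷ (3 , 5) ∷ (3 , 6) ∷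
         (4 , 5) ∷ (4 , 6) ∷ (5 , 6) ∷ []
  forward backward : Vec (ℕ × Bool) 21
  forward  = (2 , false) ∷ (5 , false) ∷ (1 , false) ∷ (4 , false) ∷ (0 , false) ∷ (3 , false) ∷
             (9 , false) ∷ (0 , true) ∷ (6 , false) ∷ (10 , false) ∷ (7 , false) ∷ (13 , false) ∷
             (11 , false) ∷ (14 , false) ∷ (1 , true) ∷ (2 , true) ∷ (11 , true) ∷ (15 , false) ∷
             (3 , true) ∷ (12 , true) ∷ (9 , true) ∷ []
  backward = (8 , false) ∷ (6 , true) ∷ (7 , true) ∷ (15 , true) ∷ (18 , true) ∷ (14 , true) ∷
             (12 , false) ∷ (16 , false) ∷ (18 , false) ∷ (13 , true) ∷ (20 , true) ∷ (17 , false) ∷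
             (8 , true) ∷ (16 , true) ∷ (19 , true) ∷ (19 , false) ∷ (4 , true) ∷ (10 , true) ∷
             (20 , false) ∷ (17 , true) ∷ (5 , true) ∷ []
  left right : Vec ℕ 21
  left  = 0 ∷ 0 ∷ 1 ∷ 0 ∷ 3 ∷ 2 ∷ 4 ∷ 0 ∷ 0 ∷ 0 ∷ 5 ∷ 0 ∷ 4 ∷ 6 ∷ 0 ∷ 7 ∷ 0 ∷ 0 ∷ 0 ∷ 7 ∷ 0 ∷ []
  right = 1 ∷ 2 ∷ 0 ∷ 3 ∷ 0 ∷ 0 ∷ 0 ∷ 1 ∷ 4 ∷ 5 ∷ 0 ∷ 6 ∷ 0 ∷ 0 ∷ 2 ∷ 0 ∷ 6 ∷ 7 ∷ 3 ∷ 0 ∷ 5 ∷ []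

genus-5 : Attained 5 ((+ 25) / 4)
genus-5 = attain 5 8 25 9 ends (forward , backward) (left , right) refl
  where
  ends : Vec (ℕ × ℕ) 25
  ends = (0 , 1) ∷ (0 , 2) ∷ (0 , 3) ∷ (0 , 4) ∷ (0 , 5) ∷ (0 , 6) ∷ (0 , 7) ∷ (1 , 2) ∷ (1 , 3) ∷
         (1 , 5) ∷ (1 , 6) ∷ (1 , 7) ∷ (2 , 3) ∷ (2 , 4) ∷ (2 , 5) ∷ (2 , 7) ∷ (3 , 4) ∷ (3 , 6) ∷
         (3 , 7) ∷ (4 , 5) ∷ (4 , 6) ∷ (4 , 7) ∷ (5 , 6) ∷ (5 , 7) ∷ (6 , 7) ∷ []
  forward backward : Vec (ℕ × Bool) 25
  forward  = (2 , false) ∷ (3 , false) ∷ (6 , false) ∷ (0 , false) ∷ (1 , false) ∷ (4 , false) ∷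
             (5 , false) ∷ (8 , false) ∷ (0 , true) ∷ (7 , false) ∷ (11 , false) ∷ (9 , false) ∷
             (13 , false) ∷ (1 , true) ∷ (15 , false) ∷ (12 , false) ∷ (17 , false) ∷ (2 , true) ∷
             (16 , false) ∷ (21 , false) ∷ (16 , true) ∷ (3 , true) ∷ (23 , false) ∷ (19 , true) ∷
             (10 , true) ∷ []
  backward = (10 , false) ∷ (7 , true) ∷ (8 , true) ∷ (13 , true) ∷ (22 , false) ∷ (17 , true) ∷
             (21 , true) ∷ (14 , false) ∷ (12 , true) ∷ (4 , true) ∷ (22 , true) ∷ (24 , true) ∷
             (18 , false) ∷ (20 , false) ∷ (9 , true) ∷ (11 , true) ∷ (19 , false) ∷ (20 , true) ∷
             (15 , true) ∷ (14 , true) ∷ (24 , false) ∷ (23 , true) ∷ (5 , true) ∷ (18 , true) ∷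
             (6 , true) ∷ []
  left right : Vec ℕ 25
  left  = 0 ∷ 0 ∷ 1 ∷ 2 ∷ 3 ∷ 0 ∷ 0 ∷ 4 ∷ 0 ∷ 0 ∷ 0 ∷ 5 ∷ 6 ∷ 0 ∷ 4 ∷ 0 ∷ 0 ∷ 7 ∷ 6 ∷ 0 ∷ 0 ∷ 8 ∷
          3 ∷ 0 ∷ 0 ∷ []
  right = 1 ∷ 2 ∷ 0 ∷ 0 ∷ 0 ∷ 3 ∷ 0 ∷ 0 ∷ 1 ∷ 4 ∷ 5 ∷ 0 ∷ 0 ∷ 2 ∷ 0 ∷ 6 ∷ 7 ∷ 0 ∷ 0 ∷ 8 ∷ 7 ∷ 0 ∷
          0 ∷ 8 ∷ 5 ∷ []

-- The values of V_c

feasible : ∀ {g} (G : CellEmb g) → CellEmb.HasCompleteLeftWalk G → Feasible g (CellEmb.S G) (CellEmb.Ar G)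
feasible G walk = CanonicalEdges.pairs-bound (CellEmb.graph G) , CompleteLeftWalk.reduced-edge-bound G walk

not-5-9 : ∀ (G : CellEmb 1) (walk : CellEmb.HasCompleteLeftWalk G) → ¬ (CellEmb.S G ≡ 5 × CellEmb.Ar G ≡ 9)
not-5-9 G walk (S≡5 , Ar≡9) =
  nine-edges-on-five-vertices S≡5 adjacency (trans (sym Ar≡pairCount) Ar≡9) (reducedDegree-even tight)
  where
  open CellEmb G
  open CanonicalEdges graph
  open CompleteLeftWalk G walk using (module Tight)
  open Tight using (reducedDegree-even)
  tight : 2 * Ar + 3 ≡ 3 * S + 6 * 1
  tight = trans (cong (λ a → 2 * a + 3) Ar≡9) (cong (λ s → 3 * s + 6) (sym S≡5))

upper-1 : ∀ (G : CellEmb 1) → CellEmb.HasCompleteLeftWalk G → CellEmb.Vr G ℚ.≤ (+ 24) / 7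
upper-1 G walk = Vr-≤ (CellEmb.graph G) 24 6
  (ValenceBound.valence-bound 1 7 3 7 (λ S a → ¬? (S ≟ 5 ×-dec a ≟ 9)) 3 refl _ _ (feasible G walk) (not-5-9 G walk))

upper-bound : ∀ g q c K m → 3 + m ≡ 6 * g →
              {True (m * suc q ≤? c * K)} → {True (ValenceBound.small-cases? g (suc q) c K (λ _ _ → yes tt))} →
              ∀ (G : CellEmb g) → CellEmb.HasCompleteLeftWalk G → CellEmb.Vr G ℚ.≤ (+ (3 * suc q + c)) / suc q
upper-bound g q c K m 3+m≡6g {mq≤cK} {small} G walk = Vr-≤ (CellEmb.graph G) (3 * suc q + c) q
  (ValenceBound.valence-bound g (suc q) c K (λ _ _ → yes tt) m 3+m≡6g {mq≤cK} {small}
                              (CellEmb.S G) (CellEmb.Ar G) (feasible G walk) tt)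

lemma1p11 : VcAttainedOrdinary 1 ((+ 24) / 7)
    × (VcAttainedOrdinary 2 ((+ 13) / 3) × br 2 ≡ (+ 13) / 3)
    × (VcAttainedOrdinary 3 ((+ 36) / 7) × br 3 ≡ (+ 36) / 7)
    × (VcAttainedOrdinary 4 ((+ 6) / 1) × IsB 4 ((+ 6) / 1))
    × (VcAttainedOrdinary 5 ((+ 25) / 4) × br 5 ≡ (+ 25) / 4)
lemma1p11 = (upper-1 , genus-1)
          , ((upper-bound 2 2 4 7 9 refl , genus-2) , refl)
          , ((upper-bound 3 6 15 7 15 refl , genus-3) , refl)
          , ((upper-bound 4 0 3 7 21 refl , genus-4) , (+ 5) / 1 , ℚ.*≤* (ℤ.+≤+ z≤n) , refl , refl)
          , ((upper-bound 5 3 13 9 27 refl , genus-5) , refl)
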